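{- Let $n\ge 1$, $t\ge 2$ and $k_1,\dots,k_t\ge 2$ be integers. Let $B$ be the graph with vertices $a,b,a',b',y_1,\dots,y_{2n},z_1,\dots,z_{2n}$ and edges $ab$, $a'b'$, $ay_j$, $b'y_j$, $bz_j$, $a'z_j$ ($1\le j\le 2n$). For $k\ge 2$, let $H_2(k,2n)$ be obtained from $k$ disjoint copies $B_1,\dots,B_k$ of $B$ (with vertices $a_\ell,b_\ell,a'_\ell,b'_\ell,\dots$ in $B_\ell$) by identifying $b'_\ell$ with $b_{\ell+1}$ for each $\ell=1,\dots,k$ (indices modulo $k$). Then $G=H_2(k_1,2n)+\cdots+H_2(k_t,2n)$ satisfies $\chi_{la}(G)=3$.
   Context: For a graph $G$ with $q$ edges, a local antimagic labeling is a bijection $f:E(G)\to\{1,\dots,q\}$ such that, writing $f^+(u)=\sum_{e\ni u}f(e)$, we have $f^+(u)\ne f^+(v)$ for every edge $uv$. $\chi_{la}(G)$ is the minimum over all local antimagic labelings of the number of distinct values of $f^+$. $+$ denotes disjoint union. -}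

module Defs where

open import Data.Nat using (ℕ; zero; suc; _+_; _*_; _≤_; _%_)
open import Data.Nat.DivMod using (m%n<n)
open import Data.Fin using (Fin; toℕ; fromℕ<)
open import Data.Fin.Properties using () renaming (_≟_ to _≟F_)
open import Data.Fin.Permutation using (Permutation′; _⟨$⟩ʳ_)
open import Data.List using (List; []; _∷_; _++_; length; lookup; map; concatMap; allFin)
open import Data.Nat.ListAction using (sum)
open import Data.Vec using (Vec; []; _∷_)
open import Data.Product using (_×_; _,_; proj₁; proj₂; ∃; Σ)
import Data.Product.Properties as ×P
open import Data.Sum using (_⊎_; inj₁; inj₂)
import Data.Sum.Properties as ⊎P
open import Data.Bool using (if_then_else_; _∨_)
open import Data.Empty using (⊥)
open import Relation.Nullary using (yes; no; does; ¬_)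
open import Relation.Binary using (DecidableEquality)
open import Relation.Binary.PropositionalEquality using (_≡_; _≢_; refl; cong)
open import Function.Definitions using (Injective)

record Graph : Set₁ where
  field
    V     : Set
    _≟V_  : DecidableEquality V
    edges : List (V × V)

  q : ℕ
  q = length edges

  ends : Fin q → V × V
  ends = lookup edges

open Graph public

-- A labeling is a bijection E(G) → {1,…,q}; we encode it as a permutation
-- π of Fin q, the label of edge e being 1 + toℕ (π e).
Labeling : Graph → Set
Labeling G = Permutation′ (q G)

label : (G : Graph) → Labeling G → Fin (q G) → ℕ
label G π e = suc (toℕ (π ⟨$⟩ʳ e))

incident : (G : Graph) → V G → Fin (q G) → Data.Bool.Bool
incident G u e = does (_≟V_ G (proj₁ (ends G e)) u) ∨ does (_≟V_ G (proj₂ (ends G e)) u)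

vsum : (G : Graph) → Labeling G → V G → ℕ
vsum G π u = sum (map (λ e → if incident G u e then label G π e else 0) (allFin (q G)))

LocalAntimagic : (G : Graph) → Labeling G → Set
LocalAntimagic G π = ∀ (e : Fin (q G)) →
  vsum G π (proj₁ (ends G e)) ≢ vsum G π (proj₂ (ends G e))

HasNValues : {A : Set} → (A → ℕ) → ℕ → Set
HasNValues {A} g c = Σ (Fin c → ℕ) λ h →
  Injective _≡_ _≡_ h × (∀ v → ∃ λ i → g v ≡ h i) × (∀ i → ∃ λ v → g v ≡ h i)

χla≡ : Graph → ℕ → Set
χla≡ G c =
  (∃ λ (π : Labeling G) → LocalAntimagic G π × HasNValues (vsum G π) c)
  × (∀ (π : Labeling G) → LocalAntimagic G π → ∀ d → HasNValues (vsum G π) d → c ≤ d)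

_⊕_ : Graph → Graph → Graph
G ⊕ H = record
  { V = V G ⊎ V H
  ; _≟V_ = ⊎P.≡-dec (_≟V_ G) (_≟V_ H)
  ; edges = map (λ { (u , v) → inj₁ u , inj₁ v }) (edges G)
         ++ map (λ { (u , v) → inj₂ u , inj₂ v }) (edges H) }

-- The block B (with m = 2n vertices y_j and m vertices z_j) and H₂(k, m).
-- Vertex b'_ℓ of copy ℓ is identified with b_{ℓ+1}; so the vertices of
-- copy ℓ are a_ℓ, b_ℓ, a'_ℓ, y_{ℓ,j}, z_{ℓ,j}.

data VB (m : ℕ) : Set where
  va vb va' : VB m
  vy vz : Fin m → VB m

_≟VB_ : ∀ {m} → DecidableEquality (VB m)
va ≟VB va = yes refl
vb ≟VB vb = yes refl
va' ≟VB va' = yes refl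
vy i ≟VB vy j with i ≟F j
... | yes refl = yes refl
... | no ne = no λ { refl → ne refl }
vz i ≟VB vz j with i ≟F j
... | yes refl = yes refl
... | no ne = no λ { refl → ne refl }
va ≟VB vb = no λ ()
va ≟VB va' = no λ ()
va ≟VB vy _ = no λ ()
va ≟VB vz _ = no λ ()
vb ≟VB va = no λ ()
vb ≟VB va' = no λ ()
vb ≟VB vy _ = no λ ()
vb ≟VB vz _ = no λ ()
va' ≟VB va = no λ ()
va' ≟VB vb = no λ ()
va' ≟VB vy _ = no λ ()
va' ≟VB vz _ = no λ ()
vy _ ≟VB va = no λ ()
vy _ ≟VB vb = no λ ()
vy _ ≟VB va' = no λ ()
vy _ ≟VB vz _ = no λ ()
vz _ ≟VB va = no λ ()
vz _ ≟VB vb = no λ ()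
vz _ ≟VB va' = no λ ()
vz _ ≟VB vy _ = no λ ()

next : ∀ {k} → Fin k → Fin k
next {suc k} ℓ = fromℕ< (m%n<n (suc (toℕ ℓ)) (suc k))

blockEdges : ∀ k m → Fin k → List ((Fin k × VB m) × (Fin k × VB m))
blockEdges k m ℓ =
  ((ℓ , va) , (ℓ , vb)) ∷ ((ℓ , va') , (next ℓ , vb)) ∷
  concatMap (λ j →
      ((ℓ , va) , (ℓ , vy j)) ∷ ((next ℓ , vb) , (ℓ , vy j))
    ∷ ((ℓ , vb) , (ℓ , vz j)) ∷ ((ℓ , va') , (ℓ , vz j)) ∷ [])
    (allFin m)

H₂ : (k m : ℕ) → Graph
H₂ k m = record
  { V = Fin k × VB m
  ; _≟V_ = ×P.≡-dec _≟F_ _≟VB_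
  ; edges = concatMap (blockEdges k m) (allFin k) }

emptyGraph : Graph
emptyGraph = record { V = ⊥ ; _≟V_ = λ () ; edges = [] }

unionH₂ : ∀ {t} → ℕ → Vec ℕ t → Graph
unionH₂ n [] = emptyGraph
unionH₂ n (k ∷ []) = H₂ k (2 * n)
unionH₂ n (k ∷ ks@(_ ∷ _)) = H₂ k (2 * n) ⊕ unionH₂ n ks

-- If f⁺ took only two values on a component H₂(k, 2n), properness would make them alternate along
-- the cycle of copies: with X = f⁺(a_ℓ), the vertices b'_ℓ = b_{ℓ+1} and z_{ℓ,j} get X, while b_ℓ,
-- a'_ℓ, y_{ℓ,j} and a_{ℓ+1} get the other value Y.  Writing c_ℓ and d_ℓ for the parts of f⁺(b_ℓ) and
-- f⁺(b'_ℓ) contributed by copy ℓ, this gives c_{ℓ+1} + d_ℓ = X and, counting the labels of copy ℓ in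
-- two ways, d_ℓ + (1 + 2n) X = c_ℓ + (1 + 2n) Y; going once around the cycle of copies forces X = Y.
-- For the upper bound all K = k₁ + ⋯ + k_t copies of B are numbered consecutively and labelled so
-- that every a and a' gets the sum α, every b gets 2γ and every y and z gets κ = q + 2K + 1: the labels
-- on each kind of edge form an interval of 1, …, q handed out to the copies in increasing or
-- decreasing order, so that the dependence on the copy cancels in every vertex sum.

module Submission where

open import Defs
open import Data.Bool using (Bool; true; false; if_then_else_; _∨_)
open import Data.Empty using (⊥; ⊥-elim)
open import Data.Fin using (Fin; toℕ; fromℕ; inject₁) renaming (zero to fzero; suc to fsuc)
open import Data.Fin.Permutation using (Permutation; Permutation′; _⟨$⟩ʳ_; _∘ₚ_; cast-id)
open import Data.Fin.Properties using (toℕ-cast; toℕ-fromℕ<; toℕ-injective; toℕ-inject₁; toℕ<n; toℕ-fromℕ)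
  renaming (suc-injective to fsuc-injective)
open import Data.List using (List; []; _∷_; _++_; [_]; length; map; concat; concatMap; allFin; tabulate; zip; take; drop; applyUpTo; reverse)
import Data.List as List
open import Data.List.Properties
  using (map-tabulate; map-++; length-map; length-++; length-tabulate; length-take; length-drop; take++drop≡id; tabulate-cong;
         tabulate-lookup; lookup-applyUpTo; length-applyUpTo; concatMap-cong; concatMap-map; concat-++; reverse-++)
open import Data.List.Membership.Propositional using (_∈_)
open import Data.List.Membership.Propositional.Properties using (∈-concat⁺′; ∈-map⁺; ∈-allFin; ∈-++⁺ˡ; ∈-lookup)
open import Data.List.Relation.Binary.Permutation.Propositional
  using (_↭_; ↭-refl; ↭-trans; ↭-reflexive; ↭⇒↭ₛ; module PermutationReasoning)
open import Data.List.Relation.Binary.Permutation.Propositional.Properties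
  using (↭-length; ++-commutativeMonoid; ++⁺ˡ; ++⁺; ↭-reverse)
import Data.List.Relation.Binary.Permutation.Setoid as ↭ₛ
import Data.List.Relation.Binary.Permutation.Setoid.Properties as ↭ₛ
open import Data.List.Relation.Unary.All using (All; []; _∷_) renaming (lookup to All-lookup)
import Data.List.Relation.Unary.All.Properties as All
open import Data.List.Relation.Unary.Any using (here; there; index)
open import Data.List.Relation.Unary.Any.Properties using (lookup-index)
open import Data.Nat using (ℕ; zero; suc; pred; _+_; _*_; _∸_; _≤_; _<_; s≤s; z≤n; _%_)
open import Data.Nat.DivMod using (m<n⇒m%n≡m; n%n≡0)
open import Data.Nat.ListAction using (sum)
open import Data.Nat.ListAction.Properties using (sum-++)
open import Data.Nat.Properties
open import Algebra.Properties.CommutativeMonoid.Sum +-0-commutativeMonoid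
  using (sum-syntax; sum-cong-≗; sum-init-last; ∑-distrib-+)
open import Data.Nat.Tactic.RingSolver using (solve-∀)
open import Algebra.Solver.CommutativeMonoid (++-commutativeMonoid {A = ℕ}) using (solve; _⊜_; id) renaming (_⊕_ to _∙_)
open import Data.Product using (_×_; _,_; proj₁; proj₂; ∃; Σ)
open import Data.Sum using (_⊎_; inj₁; inj₂)
open import Data.Sum.Properties using (inj₁-injective; inj₂-injective)
open import Data.Vec using (Vec; []; _∷_; lookup)
import Data.Vec as Vec
open import Function using (_∘_; case_of_)
open import Function.Bundles using (mk⇔)
open import Function.Definitions using (Injective)
open import Relation.Binary using (DecidableEquality)
open import Relation.Binary.PropositionalEquality hiding ([_])
open import Relation.Nullary using (does; ¬_)
open import Relation.Nullary.Decidable using (dec-true; dec-false; does-⇔)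

∑-const : ∀ k c → ∑[ i < k ] c ≡ k * c
∑-const zero c = refl
∑-const (suc k) c = cong (c +_) (∑-const k c)

∑-zero : ∀ k (f : Fin k → ℕ) → (∀ i → f i ≡ 0) → ∑[ i < k ] f i ≡ 0
∑-zero k f f≡0 = trans (sum-cong-≗ f≡0) (trans (∑-const k 0) (*-zeroʳ k))

∑-single : ∀ {k} (f : Fin k → ℕ) i → (∀ j → j ≢ i → f j ≡ 0) → ∑[ j < k ] f j ≡ f i
∑-single {suc k} f fzero others =
  trans (cong (f fzero +_) (∑-zero k (f ∘ fsuc) (λ j → others (fsuc j) λ ()))) (+-identityʳ _)
∑-single {suc k} f (fsuc i) others =
  cong₂ _+_ (others fzero λ ()) (∑-single (f ∘ fsuc) i (λ j j≢i → others (fsuc j) (j≢i ∘ fsuc-injective)))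

∑-pair : ∀ {k} (f : Fin k → ℕ) i i′ → i ≢ i′ → (∀ j → j ≢ i → j ≢ i′ → f j ≡ 0) →
  ∑[ j < k ] f j ≡ f i + f i′
∑-pair f fzero fzero i≢i′ others = ⊥-elim (i≢i′ refl)
∑-pair {suc k} f fzero (fsuc i′) i≢i′ others =
  cong (f fzero +_) (∑-single (f ∘ fsuc) i′ λ j j≢i′ → others (fsuc j) (λ ()) (j≢i′ ∘ fsuc-injective))
∑-pair {suc k} f (fsuc i) fzero i≢i′ others =
  trans (cong (f fzero +_) (∑-single (f ∘ fsuc) i λ j j≢i → others (fsuc j) (j≢i ∘ fsuc-injective) (λ ())))
        (+-comm (f fzero) _)
∑-pair {suc k} f (fsuc i) (fsuc i′) i≢i′ others =
  cong₂ _+_ (others fzero (λ ()) (λ ()))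
            (∑-pair (f ∘ fsuc) i i′ (i≢i′ ∘ cong fsuc) (λ j j≢i j≢i′ → others (fsuc j) (j≢i ∘ fsuc-injective) (j≢i′ ∘ fsuc-injective)))

∑-toℕ : ∀ n (f : ℕ → ℕ) → ∑[ j < n ] f (toℕ j) ≡ sum (applyUpTo f n)
∑-toℕ zero f = refl
∑-toℕ (suc n) f = cong (f 0 +_) (∑-toℕ n (f ∘ suc))

next-inject₁ : ∀ {k} (i : Fin k) → next {suc k} (inject₁ i) ≡ fsuc i
next-inject₁ {k} i = toℕ-injective (begin
  toℕ (next (inject₁ i))         ≡⟨ toℕ-fromℕ< _ ⟩
  suc (toℕ (inject₁ i)) % suc k ≡⟨ cong (λ x → suc x % suc k) (toℕ-inject₁ i) ⟩
  suc (toℕ i) % suc k            ≡⟨ m<n⇒m%n≡m (s≤s (toℕ<n i)) ⟩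
  suc (toℕ i)                    ∎)
  where open ≡-Reasoning

next-fromℕ : ∀ k → next {suc k} (fromℕ k) ≡ fzero
next-fromℕ k = toℕ-injective (trans (toℕ-fromℕ< _) (trans (cong (λ x → suc x % suc k) (toℕ-fromℕ k)) (n%n≡0 (suc k))))

data LastView : ∀ {k} → Fin (suc k) → Set where
  inner : ∀ {k} (i : Fin k) → LastView (inject₁ i)
  last  : ∀ {k} → LastView (fromℕ k)

lastView : ∀ {k} (ℓ : Fin (suc k)) → LastView ℓ
lastView {zero} fzero = last
lastView {suc k} fzero = inner fzero
lastView {suc k} (fsuc ℓ) with lastView ℓ
... | inner i = inner (fsuc i)
... | last = last

prev : ∀ {k} → Fin (suc k) → Fin (suc k)
prev fzero = fromℕ _
prev (fsuc i) = inject₁ i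

next-prev : ∀ {k} (ℓ : Fin (suc k)) → next (prev ℓ) ≡ ℓ
next-prev {k} fzero = next-fromℕ k
next-prev (fsuc i) = next-inject₁ i

prev-next : ∀ {k} (ℓ : Fin (suc k)) → prev (next ℓ) ≡ ℓ
prev-next ℓ with lastView ℓ
... | inner i rewrite next-inject₁ i = refl
... | last {k} rewrite next-fromℕ k = refl

next-injective : ∀ {k} {ℓ ℓ′ : Fin (suc k)} → next ℓ ≡ next ℓ′ → ℓ ≡ ℓ′
next-injective {ℓ = ℓ} {ℓ′} eq = trans (sym (prev-next ℓ)) (trans (cong prev eq) (prev-next ℓ′))

next≢id : ∀ {k} (ℓ : Fin (suc (suc k))) → next ℓ ≢ ℓ
next≢id ℓ with lastView ℓ
... | inner i = λ eq → fsuc≢inject₁ i (trans (sym (next-inject₁ i)) eq)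
  where
  fsuc≢inject₁ : ∀ {k} (i : Fin k) → fsuc i ≢ inject₁ i
  fsuc≢inject₁ (fsuc i) eq = fsuc≢inject₁ i (fsuc-injective eq)
... | last = λ eq → 0≢last (trans (sym (next-fromℕ _)) eq)
  where
  0≢last : ∀ {k} → fzero ≢ fromℕ (suc k)
  0≢last ()

∑-next : ∀ {k} (f : Fin (suc k) → ℕ) → ∑[ ℓ < suc k ] f (next ℓ) ≡ ∑[ ℓ < suc k ] f ℓ
∑-next {k} f = begin
  ∑[ ℓ < suc k ] f (next ℓ)                                ≡⟨ sum-init-last (f ∘ next) ⟩
  ∑[ i < k ] f (next (inject₁ i)) + f (next (fromℕ k))     ≡⟨ cong₂ _+_ (sum-cong-≗ (cong f ∘ next-inject₁)) (cong f (next-fromℕ k)) ⟩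
  ∑[ i < k ] f (fsuc i) + f fzero                          ≡⟨ +-comm _ (f fzero) ⟩
  ∑[ ℓ < suc k ] f ℓ                                       ∎
  where open ≡-Reasoning

cyclic-balance : ∀ {k} (f g : Fin (suc k) → ℕ) a b →
  (∀ ℓ → f ℓ + g (next ℓ) + a ≡ g ℓ + f (next ℓ) + b) → a ≡ b
cyclic-balance {k} f g a b step =
  *-cancelˡ-≡ a b (suc k) (+-cancelˡ-≡ (∑ f + ∑ g) _ _ (begin
    ∑ f + ∑ g + suc k * a                                      ≡⟨ cong₂ (λ x y → ∑ f + x + y) (sym (∑-next g)) (sym (∑-const (suc k) a)) ⟩
    ∑ f + ∑ (g ∘ next) + ∑[ ℓ < suc k ] a                      ≡⟨ cong (_+ ∑[ ℓ < suc k ] a) (sym (∑-distrib-+ f (g ∘ next))) ⟩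
    ∑[ ℓ < suc k ] (f ℓ + g (next ℓ)) + ∑[ ℓ < suc k ] a       ≡⟨ sym (∑-distrib-+ (λ ℓ → f ℓ + g (next ℓ)) (λ _ → a)) ⟩
    ∑[ ℓ < suc k ] (f ℓ + g (next ℓ) + a)                      ≡⟨ sum-cong-≗ step ⟩
    ∑[ ℓ < suc k ] (g ℓ + f (next ℓ) + b)                      ≡⟨ ∑-distrib-+ (λ ℓ → g ℓ + f (next ℓ)) (λ _ → b) ⟩
    ∑[ ℓ < suc k ] (g ℓ + f (next ℓ)) + ∑[ ℓ < suc k ] b       ≡⟨ cong₂ _+_ (∑-distrib-+ g (f ∘ next)) (∑-const (suc k) b) ⟩
    ∑ g + ∑ (f ∘ next) + suc k * b                             ≡⟨ cong (λ x → ∑ g + x + suc k * b) (∑-next f) ⟩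
    ∑ g + ∑ f + suc k * b                                      ≡⟨ cong (_+ suc k * b) (+-comm (∑ g) (∑ f)) ⟩
    ∑ f + ∑ g + suc k * b                                      ∎))
  where
  open ≡-Reasoning
  ∑ : (Fin (suc k) → ℕ) → ℕ
  ∑ f = ∑[ ℓ < suc k ] f ℓ

zip-++ : ∀ {A B : Set} (xs : List A) (ys : List B) {xs′ ys′} → length xs ≡ length ys →
  zip (xs ++ xs′) (ys ++ ys′) ≡ zip xs ys ++ zip xs′ ys′
zip-++ [] [] eq = refl
zip-++ (x ∷ xs) (y ∷ ys) eq = cong ((x , y) ∷_) (zip-++ xs ys (suc-injective eq))

zip-tabulate : ∀ {A B : Set} (xs : List A) (f : Fin (length xs) → B) →
  zip xs (tabulate f) ≡ tabulate (λ i → List.lookup xs i , f i)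
zip-tabulate [] f = refl
zip-tabulate (x ∷ xs) f = cong ((x , f fzero) ∷_) (zip-tabulate xs (f ∘ fsuc))

zip-concatMap : ∀ {A B C : Set} (f : A → List B) (g : A → List C) (xs : List A) →
  (∀ x → length (f x) ≡ length (g x)) →
  zip (concatMap f xs) (concatMap g xs) ≡ concatMap (λ x → zip (f x) (g x)) xs
zip-concatMap f g [] len = refl
zip-concatMap f g (x ∷ xs) len = trans (zip-++ (f x) (g x) (len x)) (cong (zip (f x) (g x) ++_) (zip-concatMap f g xs len))

length-concatMap : ∀ {A B : Set} (f : A → List B) (xs : List A) {d} → (∀ x → length (f x) ≡ d) →
  length (concatMap f xs) ≡ length xs * d
length-concatMap f [] len = refl
length-concatMap f (x ∷ xs) len = trans (length-++ (f x)) (cong₂ _+_ (len x) (length-concatMap f xs len))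

length-concatMap-allFin : ∀ {B : Set} k (f : Fin k → List B) {d} → (∀ x → length (f x) ≡ d) →
  length (concatMap f (allFin k)) ≡ k * d
length-concatMap-allFin k f {d} len = trans (length-concatMap f (allFin k) len) (cong (_* d) (length-tabulate {n = k} (λ i → i)))

concatMap-allFin-suc : ∀ {A : Set} k (f : Fin (suc k) → List A) →
  concatMap f (allFin (suc k)) ≡ f fzero ++ concatMap (f ∘ fsuc) (allFin k)
concatMap-allFin-suc k f = cong (f fzero ++_)
  (trans (cong (concatMap f) (sym (map-tabulate (λ i → i) fsuc))) (concatMap-map f fsuc (allFin k)))

chunks : ∀ {A : Set} k d (L : List A) → length L ≡ k * d →
  Σ (Fin k → List A) λ C → (∀ i → length (C i) ≡ d) × concatMap C (allFin k) ≡ L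
chunks zero d [] len = (λ ()) , (λ ()) , refl
chunks (suc k) d L len with chunks k d (drop d L) (trans (length-drop d L) (trans (cong (_∸ d) len) (m+n∸m≡n d (k * d))))
... | C , len-C , C≡ = C′ , len-C′ , C′≡
  where
  C′ : Fin (suc k) → List _
  C′ fzero = take d L
  C′ (fsuc i) = C i
  len-C′ : ∀ i → length (C′ i) ≡ d
  len-C′ fzero = trans (length-take d L) (m≤n⇒m⊓n≡m (subst (d ≤_) (sym len) (m≤m+n d (k * d))))
  len-C′ (fsuc i) = len-C i
  C′≡ : concatMap C′ (allFin (suc k)) ≡ L
  C′≡ = trans (concatMap-allFin-suc k C′) (trans (cong (take d L ++_) C≡) (take++drop≡id d L))

applyUpTo-2*suc : ∀ {A : Set} (f : ℕ → A) n → applyUpTo f (2 * suc n) ≡ f 0 ∷ f 1 ∷ applyUpTo (f ∘ (2 +_)) (2 * n)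
applyUpTo-2*suc f n rewrite +-suc n (n + 0) = refl

applyUpTo-cong : ∀ {A : Set} {f g : ℕ → A} → (∀ i → f i ≡ g i) → ∀ n → applyUpTo f n ≡ applyUpTo g n
applyUpTo-cong f≡g zero = refl
applyUpTo-cong f≡g (suc n) = cong₂ _∷_ (f≡g 0) (applyUpTo-cong (f≡g ∘ suc) n)

applyUpTo-+ : ∀ {A : Set} (f : ℕ → A) m n → applyUpTo f (m + n) ≡ applyUpTo f m ++ applyUpTo (f ∘ (m +_)) n
applyUpTo-+ f zero n = refl
applyUpTo-+ f (suc m) n = cong (f 0 ∷_) (applyUpTo-+ (f ∘ suc) m n)

concatMap-toℕ : ∀ {A : Set} n (f : ℕ → List A) → concatMap (f ∘ toℕ) (allFin n) ≡ concat (applyUpTo f n)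
concatMap-toℕ n f = cong concat (trans (map-tabulate (λ i → i) (f ∘ toℕ)) (tabulate-toℕ n f))
  where
  tabulate-toℕ : ∀ {A : Set} n (f : ℕ → A) → tabulate (f ∘ toℕ {n}) ≡ applyUpTo f n
  tabulate-toℕ zero f = refl
  tabulate-toℕ (suc n) f = cong (f 0 ∷_) (tabulate-toℕ n (f ∘ suc))

concat-applyUpTo-++ : ∀ K (F G : ℕ → List ℕ) →
  concat (applyUpTo (λ g → F g ++ G g) K) ↭ concat (applyUpTo F K) ++ concat (applyUpTo G K)
concat-applyUpTo-++ zero F G = ↭-refl
concat-applyUpTo-++ (suc K) F G = begin
  (F 0 ++ G 0) ++ concat (applyUpTo (λ g → F (suc g) ++ G (suc g)) K)  ↭⟨ ++⁺ˡ (F 0 ++ G 0) (concat-applyUpTo-++ K (F ∘ suc) (G ∘ suc)) ⟩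
  (F 0 ++ G 0) ++ (CF ++ CG)
    ↭⟨ solve 4 (λ F₀ G₀ CF CG → (F₀ ∙ G₀) ∙ (CF ∙ CG) ⊜ (F₀ ∙ CF) ∙ (G₀ ∙ CG)) ↭-refl (F 0) (G 0) CF CG ⟩
  (F 0 ++ CF) ++ (G 0 ++ CG)                                            ∎
  where
  open PermutationReasoning
  CF CG : List ℕ
  CF = concat (applyUpTo (F ∘ suc) K)
  CG = concat (applyUpTo (G ∘ suc) K)

concat-applyUpTo-↭ : ∀ K {F G : ℕ → List ℕ} → (∀ g → F g ↭ G g) → concat (applyUpTo F K) ↭ concat (applyUpTo G K)
concat-applyUpTo-↭ zero F↭G = ↭-refl
concat-applyUpTo-↭ (suc K) F↭G = ++⁺ (F↭G 0) (concat-applyUpTo-↭ K (F↭G ∘ suc))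

concatMap-↭ : ∀ {A B : Set} {F G : A → List B} → (∀ x → F x ↭ G x) → ∀ xs → concatMap F xs ↭ concatMap G xs
concatMap-↭ F↭G [] = ↭-refl
concatMap-↭ F↭G (x ∷ xs) = ++⁺ (F↭G x) (concatMap-↭ F↭G xs)

WEdges : Set → Set
WEdges V = List ((V × V) × ℕ)

module _ {V : Set} (eq? : DecidableEquality V) where

  touches : V → V × V → Bool
  touches u e = does (eq? (proj₁ e) u) ∨ does (eq? (proj₂ e) u)

  opaque
    weightAt : V → WEdges V → ℕ
    weightAt u L = sum (map (λ p → if touches u (proj₁ p) then proj₂ p else 0) L)

    weightAt-[] : ∀ u → weightAt u [] ≡ 0
    weightAt-[] u = refl

    weightAt-++ : ∀ u L L′ → weightAt u (L ++ L′) ≡ weightAt u L + weightAt u L′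
    weightAt-++ u L L′ = trans (cong sum (map-++ _ L L′)) (sum-++ (map _ L) _)

    weightAt-hitˡ : ∀ {u x} y w L → x ≡ u → weightAt u (((x , y) , w) ∷ L) ≡ w + weightAt u L
    weightAt-hitˡ {u} {x} y w L x≡u rewrite dec-true (eq? x u) x≡u = refl

    weightAt-hitʳ : ∀ {u y} x w L → y ≡ u → weightAt u (((x , y) , w) ∷ L) ≡ w + weightAt u L
    weightAt-hitʳ {u} {y} x w L y≡u rewrite dec-true (eq? y u) y≡u with does (eq? x u)
    ... | true = refl
    ... | false = refl

    weightAt-miss : ∀ {u x y} w L → x ≢ u → y ≢ u → weightAt u (((x , y) , w) ∷ L) ≡ weightAt u L
    weightAt-miss {u} {x} {y} w L x≢u y≢u rewrite dec-false (eq? x u) x≢u | dec-false (eq? y u) y≢u = refl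

  weightAt-concatMap : ∀ {k} u (f : Fin k → WEdges V) →
    weightAt u (concatMap f (allFin k)) ≡ ∑[ i < k ] weightAt u (f i)
  weightAt-concatMap {zero} u f = weightAt-[] u
  weightAt-concatMap {suc k} u f = begin
    weightAt u (f fzero ++ concatMap f (tabulate fsuc))  ≡⟨ weightAt-++ u (f fzero) _ ⟩
    weightAt u (f fzero) + weightAt u (concatMap f (tabulate fsuc))
      ≡⟨ cong (λ L → weightAt u (f fzero) + weightAt u L)
              (trans (cong (concatMap f) (sym (map-tabulate (λ i → i) fsuc))) (concatMap-map f fsuc (allFin k))) ⟩
    weightAt u (f fzero) + weightAt u (concatMap (f ∘ fsuc) (allFin k))
      ≡⟨ cong (weightAt u (f fzero) +_) (weightAt-concatMap u (f ∘ fsuc)) ⟩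
    ∑[ i < suc k ] weightAt u (f i)                             ∎
    where open ≡-Reasoning

  Avoids : V → WEdges V → Set
  Avoids u = All λ p → proj₁ (proj₁ p) ≢ u × proj₂ (proj₁ p) ≢ u

  weightAt-avoids : ∀ {u L} → Avoids u L → weightAt u L ≡ 0
  weightAt-avoids {u} [] = weightAt-[] u
  weightAt-avoids (_∷_ {p} (x≢u , y≢u) avoids) = trans (weightAt-miss (proj₂ p) _ x≢u y≢u) (weightAt-avoids avoids)

  weightAt-hitˡ-only : ∀ {u x} y w {L} → x ≡ u → Avoids u L → weightAt u (((x , y) , w) ∷ L) ≡ w
  weightAt-hitˡ-only y w {L} x≡u avoids = trans (weightAt-hitˡ y w L x≡u) (trans (cong (w +_) (weightAt-avoids avoids)) (+-identityʳ w))

  weightAt-hitʳ-only : ∀ {u y} x w {L} → y ≡ u → Avoids u L → weightAt u (((x , y) , w) ∷ L) ≡ w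
  weightAt-hitʳ-only x w {L} y≡u avoids = trans (weightAt-hitʳ x w L y≡u) (trans (cong (w +_) (weightAt-avoids avoids)) (+-identityʳ w))

module _ {V W : Set} (eqV : DecidableEquality V) (eqW : DecidableEquality W) (f : V → W) where

  private
    mapₑ : V × V → W × W
    mapₑ e = f (proj₁ e) , f (proj₂ e)

  opaque
    unfolding weightAt

    weightAt-mapₑ : Injective _≡_ _≡_ f → ∀ u (E : List (V × V)) (L : List ℕ) →
      weightAt eqW (f u) (zip (map mapₑ E) L) ≡ weightAt eqV u (zip E L)
    weightAt-mapₑ f-inj u [] L = refl
    weightAt-mapₑ f-inj u (e ∷ E) [] = refl
    weightAt-mapₑ f-inj u (e ∷ E) (w ∷ L) =
      cong₂ _+_ (cong (λ b → if b then w else 0) (cong₂ _∨_ (same (proj₁ e)) (same (proj₂ e))))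
                (weightAt-mapₑ f-inj u E L)
      where
      same : ∀ x → does (eqW (f x) (f u)) ≡ does (eqV x u)
      same x = does-⇔ (mk⇔ f-inj (cong f)) (eqW (f x) (f u)) (eqV x u)

  weightAt-mapₑ-∉ : ∀ w → (∀ x → f x ≢ w) → (E : List (V × V)) (L : List ℕ) →
    weightAt eqW w (zip (map mapₑ E) L) ≡ 0
  weightAt-mapₑ-∉ w ∉f [] L = weightAt-[] eqW w
  weightAt-mapₑ-∉ w ∉f (e ∷ E) [] = weightAt-[] eqW w
  weightAt-mapₑ-∉ w ∉f (e ∷ E) (l ∷ L) =
    trans (weightAt-miss eqW l _ (∉f (proj₁ e)) (∉f (proj₂ e))) (weightAt-mapₑ-∉ w ∉f E L)

q-⊕ : ∀ G H → q (G ⊕ H) ≡ q G + q H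
q-⊕ G H = trans (length-++ (map _ (edges G))) (cong₂ _+_ (length-map _ (edges G)) (length-map _ (edges H)))

module _ (G H : Graph) (L₁ L₂ : List ℕ) (len₁ : length L₁ ≡ q G) where

  private
    zip-⊕ : zip (edges (G ⊕ H)) (L₁ ++ L₂) ≡ zip (map _ (edges G)) L₁ ++ zip (map _ (edges H)) L₂
    zip-⊕ = zip-++ (map _ (edges G)) L₁ (trans (length-map _ (edges G)) (sym len₁))

  weightAt-⊕ˡ : ∀ u → weightAt (_≟V_ (G ⊕ H)) (inj₁ u) (zip (edges (G ⊕ H)) (L₁ ++ L₂)) ≡ weightAt (_≟V_ G) u (zip (edges G) L₁)
  weightAt-⊕ˡ u = begin
    weightAt eq (inj₁ u) (zip (edges (G ⊕ H)) (L₁ ++ L₂))                        ≡⟨ cong (weightAt eq (inj₁ u)) zip-⊕ ⟩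
    weightAt eq (inj₁ u) (zip (map _ (edges G)) L₁ ++ zip (map _ (edges H)) L₂) ≡⟨ weightAt-++ eq (inj₁ u) _ _ ⟩
    weightAt eq (inj₁ u) (zip (map _ (edges G)) L₁) + weightAt eq (inj₁ u) (zip (map _ (edges H)) L₂)
      ≡⟨ cong₂ _+_ (weightAt-mapₑ (_≟V_ G) eq inj₁ inj₁-injective u (edges G) L₁)
                   (weightAt-mapₑ-∉ (_≟V_ H) eq inj₂ (inj₁ u) (λ _ ()) (edges H) L₂) ⟩
    weightAt (_≟V_ G) u (zip (edges G) L₁) + 0                                   ≡⟨ +-identityʳ _ ⟩
    weightAt (_≟V_ G) u (zip (edges G) L₁)                                       ∎
    where
    open ≡-Reasoning
    eq : DecidableEquality (V (G ⊕ H))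
    eq = _≟V_ (G ⊕ H)

  weightAt-⊕ʳ : ∀ u → weightAt (_≟V_ (G ⊕ H)) (inj₂ u) (zip (edges (G ⊕ H)) (L₁ ++ L₂)) ≡ weightAt (_≟V_ H) u (zip (edges H) L₂)
  weightAt-⊕ʳ u = begin
    weightAt eq (inj₂ u) (zip (edges (G ⊕ H)) (L₁ ++ L₂))                        ≡⟨ cong (weightAt eq (inj₂ u)) zip-⊕ ⟩
    weightAt eq (inj₂ u) (zip (map _ (edges G)) L₁ ++ zip (map _ (edges H)) L₂) ≡⟨ weightAt-++ eq (inj₂ u) _ _ ⟩
    weightAt eq (inj₂ u) (zip (map _ (edges G)) L₁) + weightAt eq (inj₂ u) (zip (map _ (edges H)) L₂)
      ≡⟨ cong₂ _+_ (weightAt-mapₑ-∉ (_≟V_ G) eq inj₁ (inj₂ u) (λ _ ()) (edges G) L₁)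
                   (weightAt-mapₑ (_≟V_ H) eq inj₂ inj₂-injective u (edges H) L₂) ⟩
    weightAt (_≟V_ H) u (zip (edges H) L₂)                                       ∎
    where
    open ≡-Reasoning
    eq : DecidableEquality (V (G ⊕ H))
    eq = _≟V_ (G ⊕ H)

edgeLabels : (G : Graph) → Labeling G → List ℕ
edgeLabels G π = map (label G π) (allFin (q G))

length-edgeLabels : ∀ G π → length (edgeLabels G π) ≡ q G
length-edgeLabels G π = trans (length-map (label G π) (allFin (q G))) (length-tabulate (λ i → i))

opaque
  unfolding weightAt

  vsum≡weightAt : ∀ G π u → vsum G π u ≡ weightAt (_≟V_ G) u (zip (edges G) (edgeLabels G π))
  vsum≡weightAt G π u = begin
    sum (map contribution (tabulate (λ i → i)))
      ≡⟨ cong sum (map-tabulate (λ i → i) contribution) ⟩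
    sum (tabulate contribution)
      ≡⟨ cong sum (sym (map-tabulate (λ i → ends G i , label G π i) weight)) ⟩
    sum (map weight (tabulate (λ i → ends G i , label G π i)))
      ≡⟨ cong (sum ∘ map weight) (sym (zip-tabulate (edges G) (label G π))) ⟩
    sum (map weight (zip (edges G) (tabulate (label G π))))
      ≡⟨ cong (sum ∘ map weight ∘ zip (edges G)) (sym (map-tabulate (λ i → i) (label G π))) ⟩
    weightAt (_≟V_ G) u (zip (edges G) (edgeLabels G π)) ∎
    where
    open ≡-Reasoning
    contribution : Fin (q G) → ℕ
    contribution e = if incident G u e then label G π e else 0
    weight : (V G × V G) × ℕ → ℕ
    weight p = if touches (_≟V_ G) u (proj₁ p) then proj₂ p else 0

opaque
  labeling-from-↭ : ∀ G (L : List ℕ) → L ↭ applyUpTo suc (q G) → Σ (Labeling G) λ π → edgeLabels G π ≡ L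
  labeling-from-↭ G L L↭ = from-↭ L (trans (↭-length L↭) (length-applyUpTo suc (q G))) L↭
    where
    from-↭ : ∀ (L : List ℕ) {n} → length L ≡ n → L ↭ applyUpTo suc n →
      Σ (Permutation′ n) λ π → map (λ i → suc (toℕ (π ⟨$⟩ʳ i))) (allFin n) ≡ L
    from-↭ L refl L↭ = π , trans (map-tabulate (λ i → i) _) (trans (tabulate-cong lookup-π) (tabulate-lookup L))
      where
      ρ : Permutation (length L) (length (applyUpTo suc (length L)))
      ρ = ↭ₛ.onIndices (↭⇒↭ₛ L↭)
      length-↭ : length (applyUpTo suc (length L)) ≡ length L
      length-↭ = length-applyUpTo suc (length L)
      π : Permutation′ (length L)
      π = ρ ∘ₚ cast-id length-↭
      lookup-π : ∀ i → suc (toℕ (π ⟨$⟩ʳ i)) ≡ List.lookup L i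
      lookup-π i = sym (begin
        List.lookup L i                                    ≡⟨ ↭ₛ.onIndices-lookup (setoid ℕ) (↭⇒↭ₛ L↭) i ⟩
        List.lookup (applyUpTo suc (length L)) (ρ ⟨$⟩ʳ i)  ≡⟨ lookup-applyUpTo suc (length L) (ρ ⟨$⟩ʳ i) ⟩
        suc (toℕ (ρ ⟨$⟩ʳ i))                               ≡⟨ cong suc (toℕ-cast length-↭ (ρ ⟨$⟩ʳ i)) ⟨
        suc (toℕ (π ⟨$⟩ʳ i))                               ∎)
        where open ≡-Reasoning

antimagic-∈ : ∀ G π → LocalAntimagic G π → ∀ {u v} → (u , v) ∈ edges G → vsum G π u ≢ vsum G π v
antimagic-∈ G π antimagic uv∈ =
  subst (λ e → vsum G π (proj₁ e) ≢ vsum G π (proj₂ e)) (sym (lookup-index uv∈)) (antimagic (index uv∈))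

module _ {A : Set} (g : A → ℕ) where

  three≤values : ∀ a b → g a ≢ g b → (∀ h₀ h₁ → h₀ ≢ h₁ → ¬ (∀ x → g x ≡ h₀ ⊎ g x ≡ h₁)) →
    ∀ d → HasNValues g d → 3 ≤ d
  three≤values a b ga≢gb not-two zero (h , _ , values , _) with () ← proj₁ (values a)
  three≤values a b ga≢gb not-two 1 (h , _ , values , _) with values a | values b
  ... | fzero , ga≡ | fzero , gb≡ = ⊥-elim (ga≢gb (trans ga≡ (sym gb≡)))
  three≤values a b ga≢gb not-two 2 (h , h-inj , values , _) =
    ⊥-elim (not-two (h fzero) (h (fsuc fzero)) (λ eq → case h-inj eq of λ ()) (one-of ∘ values))
    where
    one-of : ∀ {y} → (Σ (Fin 2) λ i → y ≡ h i) → y ≡ h fzero ⊎ y ≡ h (fsuc fzero)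
    one-of (fzero , y≡) = inj₁ y≡
    one-of (fsuc fzero , y≡) = inj₂ y≡
  three≤values a b ga≢gb not-two (suc (suc (suc d))) _ = s≤s (s≤s (s≤s z≤n))

  three-values : ∀ h₀ h₁ h₂ → h₀ ≢ h₁ → h₀ ≢ h₂ → h₁ ≢ h₂ → (∀ x → g x ≡ h₀ ⊎ g x ≡ h₁ ⊎ g x ≡ h₂) →
    (∃ λ x → g x ≡ h₀) → (∃ λ x → g x ≡ h₁) → (∃ λ x → g x ≡ h₂) → HasNValues g 3
  three-values h₀ h₁ h₂ h₀≢h₁ h₀≢h₂ h₁≢h₂ values attains₀ attains₁ attains₂ = h , h-inj , index-of ∘ values , attained
    where
    h : Fin 3 → ℕ
    h fzero = h₀
    h (fsuc fzero) = h₁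
    h (fsuc (fsuc fzero)) = h₂
    h-inj : Injective _≡_ _≡_ h
    h-inj {fzero} {fzero} _ = refl
    h-inj {fzero} {fsuc fzero} eq = ⊥-elim (h₀≢h₁ eq)
    h-inj {fzero} {fsuc (fsuc fzero)} eq = ⊥-elim (h₀≢h₂ eq)
    h-inj {fsuc fzero} {fzero} eq = ⊥-elim (h₀≢h₁ (sym eq))
    h-inj {fsuc fzero} {fsuc fzero} _ = refl
    h-inj {fsuc fzero} {fsuc (fsuc fzero)} eq = ⊥-elim (h₁≢h₂ eq)
    h-inj {fsuc (fsuc fzero)} {fzero} eq = ⊥-elim (h₀≢h₂ (sym eq))
    h-inj {fsuc (fsuc fzero)} {fsuc fzero} eq = ⊥-elim (h₁≢h₂ (sym eq))
    h-inj {fsuc (fsuc fzero)} {fsuc (fsuc fzero)} _ = refl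
    index-of : ∀ {y} → y ≡ h₀ ⊎ y ≡ h₁ ⊎ y ≡ h₂ → Σ (Fin 3) λ i → y ≡ h i
    index-of (inj₁ y≡) = fzero , y≡
    index-of (inj₂ (inj₁ y≡)) = fsuc fzero , y≡
    index-of (inj₂ (inj₂ y≡)) = fsuc (fsuc fzero) , y≡
    attained : ∀ i → ∃ λ x → g x ≡ h i
    attained fzero = attains₀
    attained (fsuc fzero) = attains₁
    attained (fsuc (fsuc fzero)) = attains₂

record Path : Set where
  constructor path
  field
    ay b'y bz a'z : ℕ

  labels : List ℕ
  labels = ay ∷ b'y ∷ bz ∷ a'z ∷ []

record CopyWeights (m : ℕ) : Set where
  field
    ab a'b' : ℕ
    ay b'y bz a'z : Fin m → ℕ

  at-a at-a' at-b at-b' : ℕ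
  at-a  = ab + ∑[ j < m ] ay j
  at-a' = a'b' + ∑[ j < m ] a'z j
  at-b  = ab + ∑[ j < m ] bz j
  at-b' = a'b' + ∑[ j < m ] b'y j

  pathLabels : Fin m → List ℕ
  pathLabels j = ay j ∷ b'y j ∷ bz j ∷ a'z j ∷ []

  copyLabels : List ℕ
  copyLabels = ab ∷ a'b' ∷ concatMap pathLabels (allFin m)

open CopyWeights

-- Both sides add up every weight of the copy once.
copy-balance : ∀ {m} (w : CopyWeights m) →
  at-b' w + at-a w + ∑[ j < m ] (bz w j + a'z w j) ≡ at-b w + at-a' w + ∑[ j < m ] (ay w j + b'y w j)
copy-balance {m} w = begin
  (a'b' w + ∑ (b'y w)) + (ab w + ∑ (ay w)) + ∑[ j < m ] (bz w j + a'z w j)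
    ≡⟨ cong ((a'b' w + ∑ (b'y w)) + (ab w + ∑ (ay w)) +_) (∑-distrib-+ (bz w) (a'z w)) ⟩
  (a'b' w + ∑ (b'y w)) + (ab w + ∑ (ay w)) + (∑ (bz w) + ∑ (a'z w))
    ≡⟨ rearrange (a'b' w) (ab w) (∑ (ay w)) (∑ (b'y w)) (∑ (bz w)) (∑ (a'z w)) ⟩
  (ab w + ∑ (bz w)) + (a'b' w + ∑ (a'z w)) + (∑ (ay w) + ∑ (b'y w))
    ≡⟨ cong (λ x → (ab w + ∑ (bz w)) + (a'b' w + ∑ (a'z w)) + x) (∑-distrib-+ (ay w) (b'y w)) ⟨
  (ab w + ∑ (bz w)) + (a'b' w + ∑ (a'z w)) + ∑[ j < m ] (ay w j + b'y w j) ∎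
  where
  open ≡-Reasoning
  ∑ : (Fin m → ℕ) → ℕ
  ∑ f = ∑[ j < m ] f j
  rearrange : ∀ x₁ x₂ p q r s → (x₁ + q) + (x₂ + p) + (r + s) ≡ (x₂ + r) + (x₁ + s) + (p + q)
  rearrange = solve-∀

H₂Weights : ℕ → ℕ → Set
H₂Weights k m = Fin k → CopyWeights m

module _ {k m : ℕ} where

  flatten : H₂Weights k m → List ℕ
  flatten W = concatMap (copyLabels ∘ W) (allFin k)

  length-copyLabels : (w : CopyWeights m) → length (copyLabels w) ≡ 2 + m * 4
  length-copyLabels w = cong (2 +_) (length-concatMap-allFin m (pathLabels w) λ _ → refl)

  length-blockEdges : ∀ ℓ → length (blockEdges k m ℓ) ≡ 2 + m * 4
  length-blockEdges ℓ = cong (2 +_) (length-concatMap-allFin m _ λ _ → refl)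

  q-H₂ : q (H₂ k m) ≡ k * (2 + m * 4)
  q-H₂ = length-concatMap-allFin k (blockEdges k m) length-blockEdges

  copyWeights-of : (L : List ℕ) → length L ≡ 2 + m * 4 → Σ (CopyWeights m) λ w → copyLabels w ≡ L
  copyWeights-of (x ∷ x′ ∷ L) len with chunks m 4 L (suc-injective (suc-injective len))
  ... | C , len-C , C≡ = w , cong (λ L → x ∷ x′ ∷ L) (trans (concatMap-cong pathLabels-of (allFin m)) C≡)
    where
    path-of : ∀ (xs : List ℕ) → length xs ≡ 4 → Σ Path λ p → Path.labels p ≡ xs
    path-of (p ∷ p′ ∷ r ∷ r′ ∷ []) refl = path p p′ r r′ , refl
    P : Fin m → Path
    P j = proj₁ (path-of (C j) (len-C j))
    w : CopyWeights m
    w = record { ab = x ; a'b' = x′ ; ay = Path.ay ∘ P ; b'y = Path.b'y ∘ P ; bz = Path.bz ∘ P ; a'z = Path.a'z ∘ P }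
    pathLabels-of : ∀ j → pathLabels w j ≡ C j
    pathLabels-of j = proj₂ (path-of (C j) (len-C j))

  -- Opaque, so that the type checker never unfolds the decomposition of a concrete label list.
  opaque
    weights-of : (L : List ℕ) → length L ≡ q (H₂ k m) → Σ (H₂Weights k m) λ W → flatten W ≡ L
    weights-of L len with chunks k (2 + m * 4) L (trans len q-H₂)
    ... | C , len-C , C≡ = W , trans (concatMap-cong (proj₂ ∘ copy) (allFin k)) C≡
      where
      copy : ∀ ℓ → Σ (CopyWeights m) λ w → copyLabels w ≡ C ℓ
      copy ℓ = copyWeights-of (C ℓ) (len-C ℓ)
      W : H₂Weights k m
      W = proj₁ ∘ copy

  Vertex : Set
  Vertex = Fin k × VB m

  pathEdges : Fin k → Fin m → List (Vertex × Vertex)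
  pathEdges ℓ j = ((ℓ , va) , (ℓ , vy j)) ∷ ((next ℓ , vb) , (ℓ , vy j)) ∷ ((ℓ , vb) , (ℓ , vz j)) ∷ ((ℓ , va') , (ℓ , vz j)) ∷ []

  weightedPaths : Fin k → CopyWeights m → Fin m → WEdges Vertex
  weightedPaths ℓ w j =
      (((ℓ , va) , (ℓ , vy j)) , ay w j) ∷ (((next ℓ , vb) , (ℓ , vy j)) , b'y w j)
    ∷ (((ℓ , vb) , (ℓ , vz j)) , bz w j) ∷ (((ℓ , va') , (ℓ , vz j)) , a'z w j) ∷ []

  weightedMatching : Fin k → CopyWeights m → WEdges Vertex
  weightedMatching ℓ w = (((ℓ , va) , (ℓ , vb)) , ab w) ∷ (((ℓ , va') , (next ℓ , vb)) , a'b' w) ∷ []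

  weightedCopy : Fin k → CopyWeights m → WEdges Vertex
  weightedCopy ℓ w = weightedMatching ℓ w ++ concatMap (weightedPaths ℓ w) (allFin m)

  weightedH₂ : H₂Weights k m → WEdges Vertex
  weightedH₂ W = concatMap (λ ℓ → weightedCopy ℓ (W ℓ)) (allFin k)

  zip-H₂ : ∀ W → zip (edges (H₂ k m)) (flatten W) ≡ weightedH₂ W
  zip-H₂ W = trans (zip-concatMap (blockEdges k m) (copyLabels ∘ W) (allFin k) λ ℓ → trans (length-blockEdges ℓ) (sym (length-copyLabels (W ℓ))))
                   (concatMap-cong (λ ℓ → cong (λ L → _ ∷ _ ∷ L) (zip-concatMap _ (pathLabels (W ℓ)) (allFin m) λ _ → refl)) (allFin k))

  ≢-copy : ∀ {ℓ ℓ′ : Fin k} {v v′ : VB m} → ℓ ≢ ℓ′ → (ℓ , v) ≢ (ℓ′ , v′)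
  ≢-copy ℓ≢ℓ′ eq = ℓ≢ℓ′ (cong proj₁ eq)

  ≢-vertex : ∀ {ℓ ℓ′ : Fin k} {v v′ : VB m} → v ≢ v′ → (ℓ , v) ≢ (ℓ′ , v′)
  ≢-vertex v≢v′ eq = v≢v′ (cong proj₂ eq)

  private
    weight : Vertex → WEdges Vertex → ℕ
    weight = weightAt (_≟V_ (H₂ k m))

  weight-copy : ∀ ℓ w u → weight u (weightedCopy ℓ w) ≡ weight u (weightedMatching ℓ w) + ∑[ j < m ] weight u (weightedPaths ℓ w j)
  weight-copy ℓ w u = trans (weightAt-++ _ u (weightedMatching ℓ w) _) (cong (weight u (weightedMatching ℓ w) +_) (weightAt-concatMap _ u (weightedPaths ℓ w)))

  weight-elsewhere : ∀ ℓ w u → (∀ v → (ℓ , v) ≢ u) → (next ℓ , vb) ≢ u → weight u (weightedCopy ℓ w) ≡ 0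
  weight-elsewhere ℓ w u ∉ℓ b≢u = begin
    weight u (weightedCopy ℓ w)                            ≡⟨ weight-copy ℓ w u ⟩
    weight u (weightedMatching ℓ w) + ∑[ j < m ] weight u (weightedPaths ℓ w j)
      ≡⟨ cong₂ _+_ (weightAt-avoids _ ((∉ℓ va , ∉ℓ vb) ∷ (∉ℓ va' , b≢u) ∷ []))
                   (∑-zero m _ λ j → weightAt-avoids _ ((∉ℓ va , ∉ℓ (vy j)) ∷ (b≢u , ∉ℓ (vy j)) ∷ (∉ℓ vb , ∉ℓ (vz j)) ∷ (∉ℓ va' , ∉ℓ (vz j)) ∷ [])) ⟩
    0                                                      ∎
    where open ≡-Reasoning

  weight-H₂ : ∀ W u → weight u (weightedH₂ W) ≡ ∑[ ℓ < k ] weight u (weightedCopy ℓ (W ℓ))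
  weight-H₂ W u = weightAt-concatMap _ u (λ ℓ → weightedCopy ℓ (W ℓ))

  weight-H₂-inner : ∀ W ℓ {v} → v ≢ vb → weight (ℓ , v) (weightedH₂ W) ≡ weight (ℓ , v) (weightedCopy ℓ (W ℓ))
  weight-H₂-inner W ℓ v≢b = trans (weight-H₂ W _)
    (∑-single _ ℓ λ ℓ′ ℓ′≢ℓ → weight-elsewhere ℓ′ (W ℓ′) _ (λ _ → ≢-copy ℓ′≢ℓ) (≢-vertex (v≢b ∘ sym)))

  module _ (W : H₂Weights k m) (ℓ : Fin k) where

    private
      w : CopyWeights m
      w = W ℓ

    weight-a : weight (ℓ , va) (weightedH₂ W) ≡ at-a w
    weight-a = begin
      weight u (weightedH₂ W)                                                 ≡⟨ weight-H₂-inner W ℓ (λ ()) ⟩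
      weight u (weightedCopy ℓ w)                                             ≡⟨ weight-copy ℓ w u ⟩
      weight u (weightedMatching ℓ w) + ∑[ j < m ] weight u (weightedPaths ℓ w j) ≡⟨ cong₂ _+_ matching (sum-cong-≗ on-path) ⟩
      at-a w                                                                  ∎
      where
      open ≡-Reasoning
      u : Vertex
      u = (ℓ , va)
      matching : weight u (weightedMatching ℓ w) ≡ ab w
      matching = weightAt-hitˡ-only _ _ _ refl ((≢-vertex (λ ()) , ≢-vertex (λ ())) ∷ [])
      on-path : ∀ j → weight u (weightedPaths ℓ w j) ≡ ay w j
      on-path j = weightAt-hitˡ-only _ _ _ refl
        ((≢-vertex (λ ()) , ≢-vertex (λ ())) ∷ (≢-vertex (λ ()) , ≢-vertex (λ ())) ∷ (≢-vertex (λ ()) , ≢-vertex (λ ())) ∷ [])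

    weight-a' : weight (ℓ , va') (weightedH₂ W) ≡ at-a' w
    weight-a' = begin
      weight u (weightedH₂ W)                                                 ≡⟨ weight-H₂-inner W ℓ (λ ()) ⟩
      weight u (weightedCopy ℓ w)                                             ≡⟨ weight-copy ℓ w u ⟩
      weight u (weightedMatching ℓ w) + ∑[ j < m ] weight u (weightedPaths ℓ w j) ≡⟨ cong₂ _+_ matching (sum-cong-≗ on-path) ⟩
      at-a' w                                                                 ∎
      where
      open ≡-Reasoning
      u : Vertex
      u = (ℓ , va')
      matching : weight u (weightedMatching ℓ w) ≡ a'b' w
      matching = trans (weightAt-miss _ _ _ (≢-vertex (λ ())) (≢-vertex (λ ()))) (weightAt-hitˡ-only _ _ _ refl [])
      on-path : ∀ j → weight u (weightedPaths ℓ w j) ≡ a'z w j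
      on-path j = trans (weightAt-miss _ _ _ (≢-vertex (λ ())) (≢-vertex (λ ())))
              (trans (weightAt-miss _ _ _ (≢-vertex (λ ())) (≢-vertex (λ ())))
              (trans (weightAt-miss _ _ _ (≢-vertex (λ ())) (≢-vertex (λ ())))
                     (weightAt-hitˡ-only _ _ _ refl [])))

    weight-y : ∀ j → weight (ℓ , vy j) (weightedH₂ W) ≡ ay w j + b'y w j
    weight-y j = begin
      weight u (weightedH₂ W)                                                 ≡⟨ weight-H₂-inner W ℓ (λ ()) ⟩
      weight u (weightedCopy ℓ w)                                             ≡⟨ weight-copy ℓ w u ⟩
      weight u (weightedMatching ℓ w) + ∑[ i < m ] weight u (weightedPaths ℓ w i) ≡⟨ cong₂ _+_ matching (trans (∑-single _ j other-path) on-path) ⟩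
      ay w j + b'y w j                                                        ∎
      where
      open ≡-Reasoning
      u : Vertex
      u = (ℓ , vy j)
      vy-injective : ∀ {i j : Fin m} → vy i ≡ vy j → i ≡ j
      vy-injective refl = refl
      matching : weight u (weightedMatching ℓ w) ≡ 0
      matching = weightAt-avoids _ ((≢-vertex (λ ()) , ≢-vertex (λ ())) ∷ (≢-vertex (λ ()) , ≢-vertex (λ ())) ∷ [])
      other-path : ∀ i → i ≢ j → weight u (weightedPaths ℓ w i) ≡ 0
      other-path i i≢j = weightAt-avoids _
        ((≢-vertex (λ ()) , ≢-vertex (i≢j ∘ vy-injective)) ∷ (≢-vertex (λ ()) , ≢-vertex (i≢j ∘ vy-injective))
         ∷ (≢-vertex (λ ()) , ≢-vertex (λ ())) ∷ (≢-vertex (λ ()) , ≢-vertex (λ ())) ∷ [])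
      on-path : weight u (weightedPaths ℓ w j) ≡ ay w j + b'y w j
      on-path = trans (weightAt-hitʳ _ _ _ _ refl) (cong (ay w j +_)
               (weightAt-hitʳ-only _ _ _ refl ((≢-vertex (λ ()) , ≢-vertex (λ ())) ∷ (≢-vertex (λ ()) , ≢-vertex (λ ())) ∷ [])))

    weight-z : ∀ j → weight (ℓ , vz j) (weightedH₂ W) ≡ bz w j + a'z w j
    weight-z j = begin
      weight u (weightedH₂ W)                                                 ≡⟨ weight-H₂-inner W ℓ (λ ()) ⟩
      weight u (weightedCopy ℓ w)                                             ≡⟨ weight-copy ℓ w u ⟩
      weight u (weightedMatching ℓ w) + ∑[ i < m ] weight u (weightedPaths ℓ w i) ≡⟨ cong₂ _+_ matching (trans (∑-single _ j other-path) on-path) ⟩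
      bz w j + a'z w j                                                        ∎
      where
      open ≡-Reasoning
      u : Vertex
      u = (ℓ , vz j)
      vz-injective : ∀ {i j : Fin m} → vz i ≡ vz j → i ≡ j
      vz-injective refl = refl
      matching : weight u (weightedMatching ℓ w) ≡ 0
      matching = weightAt-avoids _ ((≢-vertex (λ ()) , ≢-vertex (λ ())) ∷ (≢-vertex (λ ()) , ≢-vertex (λ ())) ∷ [])
      other-path : ∀ i → i ≢ j → weight u (weightedPaths ℓ w i) ≡ 0
      other-path i i≢j = weightAt-avoids _
        ((≢-vertex (λ ()) , ≢-vertex (λ ())) ∷ (≢-vertex (λ ()) , ≢-vertex (λ ()))
         ∷ (≢-vertex (λ ()) , ≢-vertex (i≢j ∘ vz-injective)) ∷ (≢-vertex (λ ()) , ≢-vertex (i≢j ∘ vz-injective)) ∷ [])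
      on-path : weight u (weightedPaths ℓ w j) ≡ bz w j + a'z w j
      on-path = trans (weightAt-miss _ _ _ (≢-vertex (λ ())) (≢-vertex (λ ())))
            (trans (weightAt-miss _ _ _ (≢-vertex (λ ())) (≢-vertex (λ ())))
            (trans (weightAt-hitʳ _ _ _ _ refl) (cong (bz w j +_) (weightAt-hitʳ-only _ _ _ refl []))))

module _ {k m : ℕ} (W : H₂Weights (suc (suc k)) m) (ℓ : Fin (suc (suc k))) where

  private
    weight : Vertex → WEdges Vertex → ℕ
    weight = weightAt (_≟V_ (H₂ (suc (suc k)) m))
    ℓ⁺ : Fin (suc (suc k))
    ℓ⁺ = next ℓ
    ℓ⁺≢ℓ : ℓ⁺ ≢ ℓ
    ℓ⁺≢ℓ = next≢id ℓ
    ℓ⁺⁺≢ℓ⁺ : next ℓ⁺ ≢ ℓ⁺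
    ℓ⁺⁺≢ℓ⁺ = next≢id ℓ⁺

  weight-b : weight (ℓ⁺ , vb) (weightedH₂ W) ≡ at-b (W ℓ⁺) + at-b' (W ℓ)
  weight-b = begin
    weight u (weightedH₂ W)                                     ≡⟨ weight-H₂ W u ⟩
    ∑[ ℓ′ < suc (suc k) ] weight u (weightedCopy ℓ′ (W ℓ′))           ≡⟨ ∑-pair _ ℓ⁺ ℓ ℓ⁺≢ℓ other-copy ⟩
    weight u (weightedCopy ℓ⁺ (W ℓ⁺)) + weight u (weightedCopy ℓ (W ℓ))
      ≡⟨ cong₂ _+_ (trans (weight-copy ℓ⁺ (W ℓ⁺) u) (cong₂ _+_ matching⁺ (sum-cong-≗ on-path⁺)))
                   (trans (weight-copy ℓ (W ℓ) u) (cong₂ _+_ matching (sum-cong-≗ on-path))) ⟩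
    at-b (W ℓ⁺) + at-b' (W ℓ)                                   ∎
    where
    open ≡-Reasoning
    u : Vertex
    u = (ℓ⁺ , vb)
    other-copy : ∀ ℓ′ → ℓ′ ≢ ℓ⁺ → ℓ′ ≢ ℓ → weight u (weightedCopy ℓ′ (W ℓ′)) ≡ 0
    other-copy ℓ′ ℓ′≢ℓ⁺ ℓ′≢ℓ = weight-elsewhere ℓ′ (W ℓ′) u (λ _ → ≢-copy ℓ′≢ℓ⁺) (≢-copy (ℓ′≢ℓ ∘ next-injective))
    matching⁺ : weight u (weightedMatching ℓ⁺ (W ℓ⁺)) ≡ ab (W ℓ⁺)
    matching⁺ = weightAt-hitʳ-only _ _ _ refl ((≢-vertex (λ ()) , ≢-copy ℓ⁺⁺≢ℓ⁺) ∷ [])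
    on-path⁺ : ∀ j → weight u (weightedPaths ℓ⁺ (W ℓ⁺) j) ≡ bz (W ℓ⁺) j
    on-path⁺ j = trans (weightAt-miss _ _ _ (≢-vertex (λ ())) (≢-vertex (λ ())))
             (trans (weightAt-miss _ _ _ (≢-copy ℓ⁺⁺≢ℓ⁺) (≢-vertex (λ ())))
                    (weightAt-hitˡ-only _ _ _ refl ((≢-vertex (λ ()) , ≢-vertex (λ ())) ∷ [])))
    matching : weight u (weightedMatching ℓ (W ℓ)) ≡ a'b' (W ℓ)
    matching = trans (weightAt-miss _ _ _ (≢-vertex (λ ())) (≢-copy (ℓ⁺≢ℓ ∘ sym))) (weightAt-hitʳ-only _ _ _ refl [])
    on-path : ∀ j → weight u (weightedPaths ℓ (W ℓ) j) ≡ b'y (W ℓ) j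
    on-path j = trans (weightAt-miss _ _ _ (≢-vertex (λ ())) (≢-vertex (λ ())))
            (weightAt-hitˡ-only _ _ _ refl
              ((≢-copy (ℓ⁺≢ℓ ∘ sym) , ≢-vertex (λ ())) ∷ (≢-vertex (λ ()) , ≢-vertex (λ ())) ∷ []))

module _ {k m : ℕ} where

  ∈-H₂ : ∀ {ℓ e} → e ∈ blockEdges k m ℓ → e ∈ edges (H₂ k m)
  ∈-H₂ {ℓ} e∈ = ∈-concat⁺′ e∈ (∈-map⁺ (blockEdges k m) (∈-allFin ℓ))

  ∈-H₂-path : ∀ {ℓ j e} → e ∈ pathEdges ℓ j → e ∈ edges (H₂ k m)
  ∈-H₂-path {ℓ} {j} e∈ = ∈-H₂ (there (there (∈-concat⁺′ e∈ (∈-map⁺ (pathEdges ℓ) (∈-allFin j)))))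

  ab∈H₂ : ∀ ℓ → ((ℓ , va) , (ℓ , vb)) ∈ edges (H₂ k m)
  ab∈H₂ ℓ = ∈-H₂ (here refl)

  a'b'∈H₂ : ∀ ℓ → ((ℓ , va') , (next ℓ , vb)) ∈ edges (H₂ k m)
  a'b'∈H₂ ℓ = ∈-H₂ (there (here refl))

  ay∈H₂ : ∀ ℓ j → ((ℓ , va) , (ℓ , vy j)) ∈ edges (H₂ k m)
  ay∈H₂ ℓ j = ∈-H₂-path (here refl)

  b'y∈H₂ : ∀ ℓ j → ((next ℓ , vb) , (ℓ , vy j)) ∈ edges (H₂ k m)
  b'y∈H₂ ℓ j = ∈-H₂-path (there (here refl))

  a'z∈H₂ : ∀ ℓ j → ((ℓ , va') , (ℓ , vz j)) ∈ edges (H₂ k m)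
  a'z∈H₂ ℓ j = ∈-H₂-path (there (there (there (here refl))))

alternation-step : ∀ m X Y c c⁺ d → c⁺ + d ≡ X → d + X + m * X ≡ c + Y + m * Y →
  4 * c + 4 * c⁺ + (6 + 4 * m) * Y ≡ (X + Y) + (X + Y) + (6 + 4 * m) * X
alternation-step m X Y c c⁺ d c⁺+d≡X balance = +-cancelʳ-≡ (4 * d) _ _ (begin
  4 * c + 4 * c⁺ + (6 + 4 * m) * Y + 4 * d    ≡⟨ ring₁ m Y c c⁺ d ⟩
  4 * c + 4 * (c⁺ + d) + (6 + 4 * m) * Y      ≡⟨ cong (λ x → 4 * c + 4 * x + (6 + 4 * m) * Y) c⁺+d≡X ⟩
  4 * c + 4 * X + (6 + 4 * m) * Y             ≡⟨ ring₂ m X Y c ⟩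
  4 * (c + Y + m * Y) + 4 * X + 2 * Y         ≡⟨ cong (λ x → 4 * x + 4 * X + 2 * Y) balance ⟨
  4 * (d + X + m * X) + 4 * X + 2 * Y         ≡⟨ ring₃ m X Y d ⟩
  (X + Y) + (X + Y) + (6 + 4 * m) * X + 4 * d ∎)
  where
  open ≡-Reasoning
  ring₁ : ∀ m Y c c⁺ d → 4 * c + 4 * c⁺ + (6 + 4 * m) * Y + 4 * d ≡ 4 * c + 4 * (c⁺ + d) + (6 + 4 * m) * Y
  ring₁ = solve-∀
  ring₂ : ∀ m X Y c → 4 * c + 4 * X + (6 + 4 * m) * Y ≡ 4 * (c + Y + m * Y) + 4 * X + 2 * Y
  ring₂ = solve-∀
  ring₃ : ∀ m X Y d → 4 * (d + X + m * X) + 4 * X + 2 * Y ≡ (X + Y) + (X + Y) + (6 + 4 * m) * X + 4 * d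
  ring₃ = solve-∀

module NoTwoValues {k m : ℕ} (W : H₂Weights (suc (suc k)) m) (j₀ : Fin m) (val : Vertex → ℕ)
  (val≡ : ∀ u → val u ≡ weightAt (_≟V_ (H₂ (suc (suc k)) m)) u (weightedH₂ W))
  (proper : ∀ {u v} → (u , v) ∈ edges (H₂ (suc (suc k)) m) → val u ≢ val v)
  (h₀ h₁ : ℕ) (h₀≢h₁ : h₀ ≢ h₁) (two : ∀ u → val u ≡ h₀ ⊎ val u ≡ h₁) where

  Opposite : ℕ → ℕ → Set
  Opposite X Y = (X ≡ h₀ × Y ≡ h₁) ⊎ (X ≡ h₁ × Y ≡ h₀)

  opposite-sym : ∀ {X Y} → Opposite X Y → Opposite Y X
  opposite-sym (inj₁ (X≡ , Y≡)) = inj₂ (Y≡ , X≡)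
  opposite-sym (inj₂ (X≡ , Y≡)) = inj₁ (Y≡ , X≡)

  the-other : ∀ {X Y v} → Opposite X Y → v ≢ X → v ≡ h₀ ⊎ v ≡ h₁ → v ≡ Y
  the-other (inj₁ (X≡ , Y≡)) v≢X (inj₁ v≡) = ⊥-elim (v≢X (trans v≡ (sym X≡)))
  the-other (inj₁ (X≡ , Y≡)) v≢X (inj₂ v≡) = trans v≡ (sym Y≡)
  the-other (inj₂ (X≡ , Y≡)) v≢X (inj₁ v≡) = trans v≡ (sym Y≡)
  the-other (inj₂ (X≡ , Y≡)) v≢X (inj₂ v≡) = ⊥-elim (v≢X (trans v≡ (sym X≡)))

  across : ∀ {X Y u v} → Opposite X Y → val u ≡ X → (u , v) ∈ edges (H₂ (suc (suc k)) m) → val v ≡ Y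
  across o u≡X uv∈ = the-other o (λ v≡X → proper uv∈ (trans u≡X (sym v≡X))) (two _)

  across˘ : ∀ {X Y u v} → Opposite X Y → val v ≡ X → (u , v) ∈ edges (H₂ (suc (suc k)) m) → val u ≡ Y
  across˘ o v≡X uv∈ = the-other o (λ u≡X → proper uv∈ (trans u≡X (sym v≡X))) (two _)

  module Copy (ℓ : Fin (suc (suc k))) {X Y} (o : Opposite X Y) (a≡X : val (ℓ , va) ≡ X) where

    y≡Y : ∀ j → val (ℓ , vy j) ≡ Y
    y≡Y j = across o a≡X (ay∈H₂ ℓ j)

    b⁺≡X : val (next ℓ , vb) ≡ X
    b⁺≡X = across˘ (opposite-sym o) (y≡Y j₀) (b'y∈H₂ ℓ j₀)

    a'≡Y : val (ℓ , va') ≡ Y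
    a'≡Y = across˘ o b⁺≡X (a'b'∈H₂ ℓ)

    z≡X : ∀ j → val (ℓ , vz j) ≡ X
    z≡X j = across (opposite-sym o) a'≡Y (a'z∈H₂ ℓ j)

    a⁺≡Y : val (next ℓ , va) ≡ Y
    a⁺≡Y = across˘ o b⁺≡X (ab∈H₂ (next ℓ))

    b⁺-sum : at-b (W (next ℓ)) + at-b' (W ℓ) ≡ X
    b⁺-sum = trans (sym (weight-b W ℓ)) (trans (sym (val≡ _)) b⁺≡X)

    balance : at-b' (W ℓ) + X + m * X ≡ at-b (W ℓ) + Y + m * Y
    balance = begin
      at-b' w + X + m * X                                 ≡⟨ cong₂ (λ x y → at-b' w + x + y) (sym at-a≡X) (sym z-sum) ⟩
      at-b' w + at-a w + ∑[ j < m ] (bz w j + a'z w j)    ≡⟨ copy-balance w ⟩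
      at-b w + at-a' w + ∑[ j < m ] (ay w j + b'y w j)    ≡⟨ cong₂ (λ x y → at-b w + x + y) at-a'≡Y y-sum ⟩
      at-b w + Y + m * Y                                  ∎
      where
      open ≡-Reasoning
      open CopyWeights using (ay; b'y; bz; a'z)
      w : CopyWeights m
      w = W ℓ
      at-a≡X : at-a w ≡ X
      at-a≡X = trans (sym (weight-a W ℓ)) (trans (sym (val≡ _)) a≡X)
      at-a'≡Y : at-a' w ≡ Y
      at-a'≡Y = trans (sym (weight-a' W ℓ)) (trans (sym (val≡ _)) a'≡Y)
      z-sum : ∑[ j < m ] (bz w j + a'z w j) ≡ m * X
      z-sum = trans (sum-cong-≗ λ j → trans (sym (weight-z W ℓ j)) (trans (sym (val≡ _)) (z≡X j))) (∑-const m X)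
      y-sum : ∑[ j < m ] (ay w j + b'y w j) ≡ m * Y
      y-sum = trans (sum-cong-≗ λ j → trans (sym (weight-y W ℓ j)) (trans (sym (val≡ _)) (y≡Y j))) (∑-const m Y)

  -- 4 · at-b (W ℓ) and h₀ + h₁ are put on the two sides according to the value at a_ℓ;
  -- alternation-step then says that these quantities telescope around the cycle of copies.
  colour : Fin (suc (suc k)) → Bool
  colour ℓ = does (val (ℓ , va) ≟ h₀)

  pos neg : Fin (suc (suc k)) → ℕ
  pos ℓ = if colour ℓ then 4 * at-b (W ℓ) else h₀ + h₁
  neg ℓ = if colour ℓ then h₀ + h₁ else 4 * at-b (W ℓ)

  step : ∀ ℓ → pos ℓ + neg (next ℓ) + (6 + 4 * m) * h₁ ≡ neg ℓ + pos (next ℓ) + (6 + 4 * m) * h₀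
  step ℓ with two (ℓ , va)
  ... | inj₁ a≡h₀ = goal
    where
    open Copy ℓ (inj₁ (refl , refl)) a≡h₀
    goal : pos ℓ + neg (next ℓ) + (6 + 4 * m) * h₁ ≡ neg ℓ + pos (next ℓ) + (6 + 4 * m) * h₀
    goal rewrite dec-true (val (ℓ , va) ≟ h₀) a≡h₀ | dec-false (val (next ℓ , va) ≟ h₀) (h₀≢h₁ ∘ sym ∘ trans (sym a⁺≡Y)) =
      alternation-step m h₀ h₁ (at-b (W ℓ)) (at-b (W (next ℓ))) (at-b' (W ℓ)) b⁺-sum balance
  ... | inj₂ a≡h₁ = goal
    where
    open Copy ℓ (inj₂ (refl , refl)) a≡h₁
    goal : pos ℓ + neg (next ℓ) + (6 + 4 * m) * h₁ ≡ neg ℓ + pos (next ℓ) + (6 + 4 * m) * h₀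
    goal rewrite dec-false (val (ℓ , va) ≟ h₀) (h₀≢h₁ ∘ sym ∘ trans (sym a≡h₁)) | dec-true (val (next ℓ , va) ≟ h₀) a⁺≡Y =
      sym (trans (alternation-step m h₁ h₀ (at-b (W ℓ)) (at-b (W (next ℓ))) (at-b' (W ℓ)) b⁺-sum balance)
                 (cong (λ s → s + s + (6 + 4 * m) * h₁) (+-comm h₁ h₀)))

  impossible : ⊥
  impossible = h₀≢h₁ (sym (*-cancelˡ-≡ h₁ h₀ (6 + 4 * m) (cyclic-balance pos neg _ _ step)))

module _ (k m : ℕ) (j₀ : Fin m) (R : Graph) (π : Labeling (H₂ (suc (suc k)) m ⊕ R)) where

  private
    H G : Graph
    H = H₂ (suc (suc k)) m
    G = H ⊕ R
    L : List ℕ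
    L = edgeLabels G π

    length-take-L : length (take (q H) L) ≡ q H
    length-take-L = trans (length-take (q H) L)
      (m≤n⇒m⊓n≡m (subst (q H ≤_) (sym (trans (length-edgeLabels G π) (q-⊕ H R))) (m≤m+n (q H) (q R))))

    weights : Σ (H₂Weights (suc (suc k)) m) λ W → flatten W ≡ take (q H) L
    weights = weights-of (take (q H) L) length-take-L

    W : H₂Weights (suc (suc k)) m
    W = proj₁ weights

    val : Vertex → ℕ
    val u = vsum G π (inj₁ u)

    val≡ : ∀ u → val u ≡ weightAt (_≟V_ H) u (weightedH₂ W)
    val≡ u = begin
      vsum G π (inj₁ u)                                                           ≡⟨ vsum≡weightAt G π (inj₁ u) ⟩
      weightAt (_≟V_ G) (inj₁ u) (zip (edges G) L)                                ≡⟨ cong (weightAt (_≟V_ G) (inj₁ u) ∘ zip (edges G)) (take++drop≡id (q H) L) ⟨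
      weightAt (_≟V_ G) (inj₁ u) (zip (edges G) (take (q H) L ++ drop (q H) L))   ≡⟨ weightAt-⊕ˡ H R _ _ length-take-L u ⟩
      weightAt (_≟V_ H) u (zip (edges H) (take (q H) L))                          ≡⟨ cong (weightAt (_≟V_ H) u ∘ zip (edges H)) (proj₂ weights) ⟨
      weightAt (_≟V_ H) u (zip (edges H) (flatten W))                             ≡⟨ cong (weightAt (_≟V_ H) u) (zip-H₂ W) ⟩
      weightAt (_≟V_ H) u (weightedH₂ W)                                          ∎
      where open ≡-Reasoning

  χla-H₂⊕-lower : LocalAntimagic G π → ∀ d → HasNValues (vsum G π) d → 3 ≤ d
  χla-H₂⊕-lower antimagic = three≤values (vsum G π) (inj₁ (fzero , va)) (inj₁ (fzero , vb)) (proper (ab∈H₂ fzero))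
    λ h₀ h₁ h₀≢h₁ two → NoTwoValues.impossible W j₀ val val≡ proper h₀ h₁ h₀≢h₁ (two ∘ inj₁)
    where
    proper : ∀ {u v} → (u , v) ∈ edges H → val u ≢ val v
    proper uv∈ = antimagic-∈ G π antimagic (∈-++⁺ˡ (∈-map⁺ _ uv∈))

upFrom : ℕ → ℕ → List ℕ
upFrom a zero = []
upFrom a (suc n) = a ∷ upFrom (suc a) n

downTo : ℕ → ℕ → List ℕ
downTo a zero = []
downTo a (suc n) = n + a ∷ downTo a n

upFrom-++ : ∀ a n₁ n₂ → upFrom a (n₁ + n₂) ≡ upFrom a n₁ ++ upFrom (n₁ + a) n₂
upFrom-++ a zero n₂ = refl
upFrom-++ a (suc n₁) n₂ = cong (a ∷_) (trans (upFrom-++ (suc a) n₁ n₂) (cong (λ b → upFrom (suc a) n₁ ++ upFrom b n₂) (+-suc n₁ a)))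

downTo-++ : ∀ a n₁ n₂ → downTo a (n₁ + n₂) ≡ downTo (n₂ + a) n₁ ++ downTo a n₂
downTo-++ a zero n₂ = refl
downTo-++ a (suc n₁) n₂ = cong₂ _∷_ (+-assoc n₁ n₂ a) (downTo-++ a n₁ n₂)

downTo↭upFrom : ∀ a n → downTo a n ↭ upFrom a n
downTo↭upFrom a n = ↭-trans (↭-reflexive (downTo≡reverse a n)) (↭-reverse (upFrom a n))
  where
  downTo≡reverse : ∀ a n → downTo a n ≡ reverse (upFrom a n)
  downTo≡reverse a zero = refl
  downTo≡reverse a (suc n) = begin
    n + a ∷ downTo a n                          ≡⟨ cong (n + a ∷_) (downTo≡reverse a n) ⟩
    n + a ∷ reverse (upFrom a n)                ≡⟨ reverse-++ (upFrom a n) [ n + a ] ⟨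
    reverse (upFrom a n ++ [ n + a ])           ≡⟨ cong reverse (upFrom-++ a n 1) ⟨
    reverse (upFrom a (n + 1))                  ≡⟨ cong (reverse ∘ upFrom a) (+-comm n 1) ⟩
    reverse (upFrom a (suc n))                  ∎
    where open ≡-Reasoning

Progression : ℕ → (ℕ → ℕ) → Set
Progression d s = ∀ i → s (suc i) ≡ d + s i

progression-closed : ∀ {d s} → Progression d s → ∀ i → s i ≡ i * d + s 0
progression-closed step zero = refl
progression-closed {d} {s} step (suc i) = trans (step i) (trans (cong (d +_) (progression-closed step i)) (sym (+-assoc d (i * d) (s 0))))

concat-upFrom : ∀ K {d s} → Progression d s → concat (applyUpTo (λ g → upFrom (s g) d) K) ≡ upFrom (s 0) (K * d)
concat-upFrom zero step = refl
concat-upFrom (suc K) {d} {s} step = begin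
  upFrom (s 0) d ++ concat (applyUpTo (λ g → upFrom (s (suc g)) d) K) ≡⟨ cong (upFrom (s 0) d ++_) (concat-upFrom K (step ∘ suc)) ⟩
  upFrom (s 0) d ++ upFrom (s 1) (K * d)                               ≡⟨ cong (λ b → upFrom (s 0) d ++ upFrom b (K * d)) (step 0) ⟩
  upFrom (s 0) d ++ upFrom (d + s 0) (K * d)                           ≡⟨ upFrom-++ (s 0) d (K * d) ⟨
  upFrom (s 0) (d + K * d)                                             ∎
  where open ≡-Reasoning

concat-downTo : ∀ K {d s} → Progression d s → concat (applyUpTo (λ g → downTo (s (K ∸ suc g)) d) K) ≡ downTo (s 0) (K * d)
concat-downTo zero step = refl
concat-downTo (suc K) {d} {s} step = begin
  downTo (s K) d ++ concat (applyUpTo (λ g → downTo (s (K ∸ suc g)) d) K) ≡⟨ cong (downTo (s K) d ++_) (concat-downTo K step) ⟩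
  downTo (s K) d ++ downTo (s 0) (K * d)                                   ≡⟨ cong (λ b → downTo b d ++ downTo (s 0) (K * d)) (progression-closed step K) ⟩
  downTo (K * d + s 0) d ++ downTo (s 0) (K * d)                           ≡⟨ downTo-++ (s 0) d (K * d) ⟨
  downTo (s 0) (d + K * d)                                                 ∎
  where open ≡-Reasoning

upFrom≡applyUpTo : ∀ a n → upFrom a n ≡ applyUpTo (_+ a) n
upFrom≡applyUpTo a zero = refl
upFrom≡applyUpTo a (suc n) = cong (a ∷_) (trans (upFrom≡applyUpTo (suc a) n) (applyUpTo-cong (λ i → +-suc i a) n))

applyUpTo-suc : ∀ n → applyUpTo suc n ≡ upFrom 1 n
applyUpTo-suc n = sym (trans (upFrom≡applyUpTo 1 n) (applyUpTo-cong (λ i → +-comm i 1) n))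

<-2*suc⁻ : ∀ {x s} → 2 + x < 2 * suc s → x < 2 * s
<-2*suc⁻ {x} {s} lt = +-cancelˡ-< 2 x (2 * s) (subst (2 + x <_) (*-suc 2 s) lt)

-- The n pairs of paths use the labels lo, …, lo + 4n - 1 and t, …, t + 4n - 1: the i-th pair
-- takes lo + 4i, …, lo + 4i + 3 and T, …, T + 3 for T = t + 4 (n - 1 - i), so that every
-- path sum ay + b'y and bz + a'z is lo + t + 4n - 1.
restPath : ℕ → ℕ → ℕ → ℕ → Path
restPath lo t zero x = path 0 0 0 0
restPath lo t (suc s) 0 = path lo (3 + (4 * s + t)) (2 + (4 * s + t)) (1 + lo)
restPath lo t (suc s) 1 = path (1 + (4 * s + t)) (2 + lo) (3 + lo) (4 * s + t)
restPath lo t (suc s) (suc (suc x)) = restPath (4 + lo) t s x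

module _ (F G : Path → ℕ)
  (first  : ∀ lo t s → suc (F (restPath lo t (suc s) 0) + G (restPath lo t (suc s) 0)) ≡ lo + t + 4 * suc s)
  (second : ∀ lo t s → suc (F (restPath lo t (suc s) 1) + G (restPath lo t (suc s) 1)) ≡ lo + t + 4 * suc s) where

  restPath-sum : ∀ lo t n x → x < 2 * n → suc (F (restPath lo t n x) + G (restPath lo t n x)) ≡ lo + t + 4 * n
  restPath-sum lo t (suc s) 0 _ = first lo t s
  restPath-sum lo t (suc s) 1 _ = second lo t s
  restPath-sum lo t (suc s) (suc (suc x)) x< = trans (restPath-sum (4 + lo) t s x (<-2*suc⁻ x<)) (ring lo t s)
    where
    ring : ∀ lo t s → 4 + lo + t + 4 * s ≡ lo + t + 4 * suc s
    ring = solve-∀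

module _ (F : Path → ℕ) (c d : ℕ)
  (pair : ∀ lo t s → F (restPath lo t (suc s) 0) + F (restPath lo t (suc s) 1) + c ≡ lo + t + 4 * suc s + d) where

  sum-restPath : ∀ lo t n → sum (applyUpTo (F ∘ restPath lo t n) (2 * n)) + n * c ≡ n * (lo + t + 4 * n + d)
  sum-restPath lo t zero = refl
  sum-restPath lo t (suc s) = begin
    sum (applyUpTo (F ∘ restPath lo t (suc s)) (2 * suc s)) + suc s * c
      ≡⟨ cong (λ xs → sum xs + suc s * c) (applyUpTo-2*suc (F ∘ restPath lo t (suc s)) s) ⟩
    F p₀ + (F p₁ + sum (applyUpTo (F ∘ restPath (4 + lo) t s) (2 * s))) + suc s * c
      ≡⟨ regroup (F p₀) (F p₁) (sum (applyUpTo (F ∘ restPath (4 + lo) t s) (2 * s))) s c ⟩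
    (F p₀ + F p₁ + c) + (sum (applyUpTo (F ∘ restPath (4 + lo) t s) (2 * s)) + s * c)
      ≡⟨ cong₂ _+_ (pair lo t s) (sum-restPath (4 + lo) t s) ⟩
    (lo + t + 4 * suc s + d) + s * (4 + lo + t + 4 * s + d)
      ≡⟨ ring lo t s d ⟩
    suc s * (lo + t + 4 * suc s + d) ∎
    where
    open ≡-Reasoning
    p₀ p₁ : Path
    p₀ = restPath lo t (suc s) 0
    p₁ = restPath lo t (suc s) 1
    regroup : ∀ x y r s c → x + (y + r) + suc s * c ≡ (x + y + c) + (r + s * c)
    regroup = solve-∀
    ring : ∀ lo t s d → (lo + t + 4 * suc s + d) + s * (4 + lo + t + 4 * s + d) ≡ suc s * (lo + t + 4 * suc s + d)
    ring = solve-∀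

restPath-y : ∀ lo t n x → x < 2 * n → suc (Path.ay (restPath lo t n x) + Path.b'y (restPath lo t n x)) ≡ lo + t + 4 * n
restPath-y = restPath-sum Path.ay Path.b'y ring₀ ring₁
  where
  ring₀ : ∀ lo t s → suc (lo + (3 + (4 * s + t))) ≡ lo + t + 4 * suc s
  ring₀ = solve-∀
  ring₁ : ∀ lo t s → suc (1 + (4 * s + t) + (2 + lo)) ≡ lo + t + 4 * suc s
  ring₁ = solve-∀

restPath-z : ∀ lo t n x → x < 2 * n → suc (Path.bz (restPath lo t n x) + Path.a'z (restPath lo t n x)) ≡ lo + t + 4 * n
restPath-z = restPath-sum Path.bz Path.a'z ring₀ ring₁
  where
  ring₀ : ∀ lo t s → suc (2 + (4 * s + t) + (1 + lo)) ≡ lo + t + 4 * suc s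
  ring₀ = solve-∀
  ring₁ : ∀ lo t s → suc (3 + lo + (4 * s + t)) ≡ lo + t + 4 * suc s
  ring₁ = solve-∀

sum-restPath-ay : ∀ lo t n → sum (applyUpTo (Path.ay ∘ restPath lo t n) (2 * n)) + n * 3 ≡ n * (lo + t + 4 * n + 0)
sum-restPath-ay = sum-restPath Path.ay 3 0 ring
  where
  ring : ∀ lo t s → lo + (1 + (4 * s + t)) + 3 ≡ lo + t + 4 * suc s + 0
  ring = solve-∀

sum-restPath-a'z : ∀ lo t n → sum (applyUpTo (Path.a'z ∘ restPath lo t n) (2 * n)) + n * 3 ≡ n * (lo + t + 4 * n + 0)
sum-restPath-a'z = sum-restPath Path.a'z 3 0 ring
  where
  ring : ∀ lo t s → 1 + lo + (4 * s + t) + 3 ≡ lo + t + 4 * suc s + 0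
  ring = solve-∀

sum-restPath-b'y : ∀ lo t n → sum (applyUpTo (Path.b'y ∘ restPath lo t n) (2 * n)) + n * 0 ≡ n * (lo + t + 4 * n + 1)
sum-restPath-b'y = sum-restPath Path.b'y 0 1 ring
  where
  ring : ∀ lo t s → 3 + (4 * s + t) + (2 + lo) + 0 ≡ lo + t + 4 * suc s + 1
  ring = solve-∀

sum-restPath-bz : ∀ lo t n → sum (applyUpTo (Path.bz ∘ restPath lo t n) (2 * n)) + n * 0 ≡ n * (lo + t + 4 * n + 1)
sum-restPath-bz = sum-restPath Path.bz 0 1 ring
  where
  ring : ∀ lo t s → 2 + (4 * s + t) + (3 + lo) + 0 ≡ lo + t + 4 * suc s + 1
  ring = solve-∀

restPath-labels-↭ : ∀ lo t n → concat (applyUpTo (Path.labels ∘ restPath lo t n) (2 * n)) ↭ upFrom lo (4 * n) ++ downTo t (4 * n)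
restPath-labels-↭ lo t zero = ↭-refl
restPath-labels-↭ lo t (suc s) = begin
  concat (applyUpTo L (2 * suc s))                                ≡⟨ cong concat (applyUpTo-2*suc L s) ⟩
  L 0 ++ L 1 ++ concat (applyUpTo (Path.labels ∘ restPath (4 + lo) t s) (2 * s))
    ↭⟨ ++⁺ˡ (L 0 ++ L 1) (restPath-labels-↭ (4 + lo) t s) ⟩
  L 0 ++ L 1 ++ U ++ D
    ↭⟨ solve 10 (λ a₀ a₁ a₂ a₃ b₀ b₁ b₂ b₃ U D →
                  a₀ ∙ b₃ ∙ b₂ ∙ a₁ ∙ b₁ ∙ a₂ ∙ a₃ ∙ b₀ ∙ U ∙ D ⊜ (a₀ ∙ a₁ ∙ a₂ ∙ a₃ ∙ U) ∙ (b₃ ∙ b₂ ∙ b₁ ∙ b₀ ∙ D))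
                ↭-refl [ lo ] [ 1 + lo ] [ 2 + lo ] [ 3 + lo ] [ T ] [ 1 + T ] [ 2 + T ] [ 3 + T ] U D ⟩
  upFrom lo (4 + 4 * s) ++ downTo t (4 + 4 * s)                   ≡⟨ cong (λ n → upFrom lo n ++ downTo t n) (*-suc 4 s) ⟨
  upFrom lo (4 * suc s) ++ downTo t (4 * suc s)                   ∎
  where
  open PermutationReasoning
  L : ℕ → List ℕ
  L = Path.labels ∘ restPath lo t (suc s)
  T : ℕ
  T = 4 * s + t
  U D : List ℕ
  U = upFrom (4 + lo) (4 * s)
  D = downTo t (4 * s)

-- The first of the d labels c + i d + 1, …, c + i d + d that a class of labels following c gives to copy i.
start : ℕ → ℕ → ℕ → ℕ
start c d i = c + suc (i * d)

start-progression : ∀ c d → Progression d (start c d)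
start-progression c d i = ring c d i
  where
  ring : ∀ c d i → c + suc (d + i * d) ≡ d + (c + suc (i * d))
  ring = solve-∀

-- Copy g of K, followed by h = K - 1 - g further copies; it has 2 + 2N paths.
module Block (K N g h : ℕ) where

  O : ℕ
  O = 4 * N * K

  low high : ℕ
  low = start (2 * K) (4 * N) g
  high = start (10 * K + O) (4 * N) h

  pathAt : ℕ → Path
  pathAt 0 = path (start (2 * K + O) 1 g) (start (9 * K + O) 1 h) (start (8 * K + O) 1 g) (start (3 * K + O) 1 h)
  pathAt 1 = path (suc (start (6 * K + O) 2 h)) (start (4 * K + O) 2 g) (start (6 * K + O) 2 h) (suc (start (4 * K + O) 2 g))
  pathAt (suc (suc x)) = restPath low high N x

  weights : CopyWeights (2 * suc N)
  weights = record
    { ab = start 0 1 g ; a'b' = start K 1 h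
    ; ay = Path.ay ∘ pathAt ∘ toℕ ; b'y = Path.b'y ∘ pathAt ∘ toℕ ; bz = Path.bz ∘ pathAt ∘ toℕ ; a'z = Path.a'z ∘ pathAt ∘ toℕ }

  sum-paths : ∀ (F : Path → ℕ) →
    ∑[ j < 2 * suc N ] F (pathAt (toℕ j)) ≡ F (pathAt 0) + (F (pathAt 1) + sum (applyUpTo (F ∘ restPath low high N) (2 * N)))
  sum-paths F = trans (∑-toℕ (2 * suc N) (F ∘ pathAt)) (cong sum (applyUpTo-2*suc (F ∘ pathAt) N))

α γ κ : ℕ → ℕ → ℕ
α K N = let O = 4 * N * K in 10 * K + 2 * O + 2 + N * (12 * pred K + 2 * O + 11)
γ K N = let O = 4 * N * K in 16 * K + 2 * O + 1 + N * (12 * K + 2 * O + 3)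
κ K N = let O = 4 * N * K in 12 * K + 2 * O + 1

-- The sums over the paths beyond the first two are only known after adding N * c.
+-cancel-rest : ∀ x₀ x₁ x₂ R c N S v → R + N * c ≡ N * S → x₀ + x₁ + x₂ + N * S ≡ v + N * c → x₀ + (x₁ + (x₂ + R)) ≡ v
+-cancel-rest x₀ x₁ x₂ R c N S v rest total = +-cancelʳ-≡ (N * c) _ _ (begin
  x₀ + (x₁ + (x₂ + R)) + N * c  ≡⟨ regroup x₀ x₁ x₂ R (N * c) ⟩
  x₀ + x₁ + x₂ + (R + N * c)    ≡⟨ cong (x₀ + x₁ + x₂ +_) rest ⟩
  x₀ + x₁ + x₂ + N * S          ≡⟨ total ⟩
  v + N * c                     ∎)
  where
  open ≡-Reasoning
  regroup : ∀ x₀ x₁ x₂ R y → x₀ + (x₁ + (x₂ + R)) + y ≡ x₀ + x₁ + x₂ + (R + y)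
  regroup = solve-∀

module _ (N : ℕ) where

  at-a-block : ∀ {K} g h → K ≡ suc (g + h) → at-a (Block.weights K N g h) ≡ α K N
  at-a-block g h refl = trans (cong (start 0 1 g +_) (sum-paths Path.ay))
    (+-cancel-rest (start 0 1 g) (Path.ay (pathAt 0)) (Path.ay (pathAt 1)) _ 3 N _ _ (sum-restPath-ay low high N) (ring g h N))
    where
    open Block (suc (g + h)) N g h
    ring : ∀ g h N → let K = suc (g + h) ; O = 4 * N * K in
      suc (g * 1) + (2 * K + O + suc (g * 1)) + suc (6 * K + O + suc (h * 2))
        + N * ((2 * K + suc (g * (4 * N))) + (10 * K + O + suc (h * (4 * N))) + 4 * N + 0)
      ≡ 10 * K + 2 * O + 2 + N * (12 * (g + h) + 2 * O + 11) + N * 3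
    ring = solve-∀

  at-a'-block : ∀ {K} g h → K ≡ suc (g + h) → at-a' (Block.weights K N g h) ≡ α K N
  at-a'-block g h refl = trans (cong (start (suc (g + h)) 1 h +_) (sum-paths Path.a'z))
    (+-cancel-rest (start (suc (g + h)) 1 h) (Path.a'z (pathAt 0)) (Path.a'z (pathAt 1)) _ 3 N _ _ (sum-restPath-a'z low high N) (ring g h N))
    where
    open Block (suc (g + h)) N g h
    ring : ∀ g h N → let K = suc (g + h) ; O = 4 * N * K in
      K + suc (h * 1) + (3 * K + O + suc (h * 1)) + suc (4 * K + O + suc (g * 2))
        + N * ((2 * K + suc (g * (4 * N))) + (10 * K + O + suc (h * (4 * N))) + 4 * N + 0)
      ≡ 10 * K + 2 * O + 2 + N * (12 * (g + h) + 2 * O + 11) + N * 3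
    ring = solve-∀

  at-b-block : ∀ {K} g h → K ≡ suc (g + h) → at-b (Block.weights K N g h) ≡ γ K N
  at-b-block g h refl = trans (cong (start 0 1 g +_) (sum-paths Path.bz))
    (+-cancel-rest (start 0 1 g) (Path.bz (pathAt 0)) (Path.bz (pathAt 1)) _ 0 N _ _ (sum-restPath-bz low high N) (ring g h N))
    where
    open Block (suc (g + h)) N g h
    ring : ∀ g h N → let K = suc (g + h) ; O = 4 * N * K in
      suc (g * 1) + (8 * K + O + suc (g * 1)) + (6 * K + O + suc (h * 2))
        + N * ((2 * K + suc (g * (4 * N))) + (10 * K + O + suc (h * (4 * N))) + 4 * N + 1)
      ≡ 16 * K + 2 * O + 1 + N * (12 * K + 2 * O + 3) + N * 0
    ring = solve-∀

  at-b'-block : ∀ {K} g h → K ≡ suc (g + h) → at-b' (Block.weights K N g h) ≡ γ K N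
  at-b'-block g h refl = trans (cong (start (suc (g + h)) 1 h +_) (sum-paths Path.b'y))
    (+-cancel-rest (start (suc (g + h)) 1 h) (Path.b'y (pathAt 0)) (Path.b'y (pathAt 1)) _ 0 N _ _ (sum-restPath-b'y low high N) (ring g h N))
    where
    open Block (suc (g + h)) N g h
    ring : ∀ g h N → let K = suc (g + h) ; O = 4 * N * K in
      K + suc (h * 1) + (9 * K + O + suc (h * 1)) + (4 * K + O + suc (g * 2))
        + N * ((2 * K + suc (g * (4 * N))) + (10 * K + O + suc (h * (4 * N))) + 4 * N + 1)
      ≡ 16 * K + 2 * O + 1 + N * (12 * K + 2 * O + 3) + N * 0
    ring = solve-∀

  y-block : ∀ {K} g h → K ≡ suc (g + h) → ∀ j → ay (Block.weights K N g h) j + b'y (Block.weights K N g h) j ≡ κ K N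
  y-block g h refl j = path-y (toℕ j) (toℕ<n j)
    where
    open Block (suc (g + h)) N g h
    path-y : ∀ x → x < 2 * suc N → Path.ay (pathAt x) + Path.b'y (pathAt x) ≡ κ (suc (g + h)) N
    path-y 0 _ = ring g h N
      where
      ring : ∀ g h N → let K = suc (g + h) ; O = 4 * N * K in
        2 * K + O + suc (g * 1) + (9 * K + O + suc (h * 1)) ≡ 12 * K + 2 * O + 1
      ring = solve-∀
    path-y 1 _ = ring g h N
      where
      ring : ∀ g h N → let K = suc (g + h) ; O = 4 * N * K in
        suc (6 * K + O + suc (h * 2)) + (4 * K + O + suc (g * 2)) ≡ 12 * K + 2 * O + 1
      ring = solve-∀
    path-y (suc (suc x)) x< = suc-injective (trans (restPath-y low high N x (<-2*suc⁻ x<)) (ring g h N))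
      where
      ring : ∀ g h N → let K = suc (g + h) ; O = 4 * N * K in
        2 * K + suc (g * (4 * N)) + (10 * K + O + suc (h * (4 * N))) + 4 * N ≡ suc (12 * K + 2 * O + 1)
      ring = solve-∀

  z-block : ∀ {K} g h → K ≡ suc (g + h) → ∀ j → bz (Block.weights K N g h) j + a'z (Block.weights K N g h) j ≡ κ K N
  z-block g h refl j = path-z (toℕ j) (toℕ<n j)
    where
    open Block (suc (g + h)) N g h
    path-z : ∀ x → x < 2 * suc N → Path.bz (pathAt x) + Path.a'z (pathAt x) ≡ κ (suc (g + h)) N
    path-z 0 _ = ring g h N
      where
      ring : ∀ g h N → let K = suc (g + h) ; O = 4 * N * K in
        8 * K + O + suc (g * 1) + (3 * K + O + suc (h * 1)) ≡ 12 * K + 2 * O + 1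
      ring = solve-∀
    path-z 1 _ = ring g h N
      where
      ring : ∀ g h N → let K = suc (g + h) ; O = 4 * N * K in
        6 * K + O + suc (h * 2) + suc (4 * K + O + suc (g * 2)) ≡ 12 * K + 2 * O + 1
      ring = solve-∀
    path-z (suc (suc x)) x< = suc-injective (trans (restPath-z low high N x (<-2*suc⁻ x<)) (ring g h N))
      where
      ring : ∀ g h N → let K = suc (g + h) ; O = 4 * N * K in
        2 * K + suc (g * (4 * N)) + (10 * K + O + suc (h * (4 * N))) + 4 * N ≡ suc (12 * K + 2 * O + 1)
      ring = solve-∀

module _ (K′ N : ℕ) where

  private
    K : ℕ
    K = suc K′

  α≢γ+γ : α K N ≢ γ K N + γ K N
  α≢γ+γ eq = m≢1+m+n (α K N) (trans eq (ring K′ N))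
    where
    ring : ∀ K′ N → let K = suc K′ ; O = 4 * N * K in
      16 * K + 2 * O + 1 + N * (12 * K + 2 * O + 3) + (16 * K + 2 * O + 1 + N * (12 * K + 2 * O + 3))
      ≡ suc (10 * K + 2 * O + 2 + N * (12 * K′ + 2 * O + 11) + (22 * K′ + 21 + 2 * O + N * (12 * K + 2 * O + 7)))
    ring = solve-∀

  κ≢γ+γ : κ K N ≢ γ K N + γ K N
  κ≢γ+γ eq = m≢1+m+n (κ K N) (trans eq (ring K′ N))
    where
    ring : ∀ K′ N → let K = suc K′ ; O = 4 * N * K in
      16 * K + 2 * O + 1 + N * (12 * K + 2 * O + 3) + (16 * K + 2 * O + 1 + N * (12 * K + 2 * O + 3))
      ≡ suc (12 * K + 2 * O + 1 + (20 * K + 2 * O + 2 * N * (12 * K + 2 * O + 3)))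
    ring = solve-∀

α≢κ : ∀ K′ N → α (suc K′) N ≢ κ (suc K′) N
α≢κ K′ zero eq = m≢1+m+n (α (suc K′) 0) (trans eq (ring K′))
  where
  ring : ∀ K′ → let K = suc K′ ; O = 4 * 0 * K in
    12 * K + 2 * O + 1 ≡ suc (10 * K + 2 * O + 2 + 0 * (12 * K′ + 2 * O + 11) + 2 * K′)
  ring = solve-∀
α≢κ K′ (suc s) eq = m≢1+m+n (κ (suc K′) (suc s)) (trans (sym eq) (ring K′ s))
  where
  ring : ∀ K′ s → let K = suc K′ ; N = suc s ; O = 4 * N * K in
    10 * K + 2 * O + 2 + N * (12 * K′ + 2 * O + 11) ≡ suc (12 * K + 2 * O + 1 + (10 * K′ + 9 + 2 * O + s * (12 * K′ + 2 * O + 11)))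
  ring = solve-∀

data Order : Set where
  ascending descending : Order

-- Labels offset + 1, …, offset + K * width, handed out width at a time to the K copies,
-- copy g receiving the g-th (ascending) or the (K - 1 - g)-th (descending) group.
record LabelClass : Set where
  constructor class
  field
    offset width : ℕ
    order : Order

open LabelClass

piece : ℕ → LabelClass → ℕ → List ℕ
piece K (class c d ascending) g = upFrom (start c d g) d
piece K (class c d descending) g = downTo (start c d (K ∸ suc g)) d

concat-piece : ∀ K cl → concat (applyUpTo (piece K cl) K) ↭ upFrom (offset cl + 1) (K * width cl)
concat-piece K (class c d ascending) = ↭-reflexive (concat-upFrom K (start-progression c d))
concat-piece K (class c d descending) =
  ↭-trans (↭-reflexive (concat-downTo K (start-progression c d))) (downTo↭upFrom (start c d 0) (K * d))

data Tiling (K : ℕ) : ℕ → List LabelClass → ℕ → Set where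
  []   : ∀ {c} → Tiling K c [] 0
  tile : ∀ {c c′ d o cls n} → c′ ≡ K * d + c → Tiling K c′ cls n → Tiling K c (class c d o ∷ cls) (K * d + n)

tiling-upFrom : ∀ {K c cls n} → Tiling K c cls n → concatMap (λ cl → upFrom (offset cl + 1) (K * width cl)) cls ≡ upFrom (c + 1) n
tiling-upFrom [] = refl
tiling-upFrom {K} {c} (tile {d = d} {n = n} refl tiling) = begin
  upFrom (c + 1) (K * d) ++ _                          ≡⟨ cong (upFrom (c + 1) (K * d) ++_) (tiling-upFrom tiling) ⟩
  upFrom (c + 1) (K * d) ++ upFrom (K * d + c + 1) n   ≡⟨ cong (λ a → upFrom (c + 1) (K * d) ++ upFrom a n) (+-assoc (K * d) c 1) ⟩
  upFrom (c + 1) (K * d) ++ upFrom (K * d + (c + 1)) n ≡⟨ upFrom-++ (c + 1) (K * d) n ⟨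
  upFrom (c + 1) (K * d + n)                           ∎
  where open ≡-Reasoning

distribute : ∀ K cls → concat (applyUpTo (λ g → concatMap (λ cl → piece K cl g) cls) K) ↭ concatMap (λ cl → concat (applyUpTo (piece K cl) K)) cls
distribute K [] = ↭-reflexive (concat-[] K)
  where
  concat-[] : ∀ K → concat (applyUpTo (λ _ → []) K) ≡ []
  concat-[] zero = refl
  concat-[] (suc K) = concat-[] K
distribute K (cl ∷ cls) = ↭-trans (concat-applyUpTo-++ K (piece K cl) (λ g → concatMap (λ cl → piece K cl g) cls))
                                  (++⁺ˡ _ (distribute K cls))

classes : ℕ → ℕ → List LabelClass
classes K N = let O = 4 * N * K in
    class 0 1 ascending ∷ class K 1 descending ∷ class (2 * K) (4 * N) ascending
  ∷ class (2 * K + O) 1 ascending ∷ class (3 * K + O) 1 descending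
  ∷ class (4 * K + O) 2 ascending ∷ class (6 * K + O) 2 descending
  ∷ class (8 * K + O) 1 ascending ∷ class (9 * K + O) 1 descending
  ∷ class (10 * K + O) (4 * N) descending ∷ []

classes-tiling : ∀ K N → Tiling K 0 (classes K N) (K * (2 + 2 * suc N * 4))
classes-tiling K N = subst (Tiling K 0 (classes K N)) (total K N)
  (tile (ring₁ K) (tile (ring₂ K) (tile (ring₃ K N) (tile (ring₄ K N) (tile (ring₅ K N)
  (tile (ring₆ K N) (tile (ring₇ K N) (tile (ring₈ K N) (tile (ring₉ K N) (tile {d = 4 * N} refl []))))))))))
  where
  ring₁ : ∀ K → K ≡ K * 1 + 0
  ring₁ = solve-∀
  ring₂ : ∀ K → 2 * K ≡ K * 1 + K
  ring₂ = solve-∀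
  ring₃ : ∀ K N → 2 * K + 4 * N * K ≡ K * (4 * N) + 2 * K
  ring₃ = solve-∀
  ring₄ : ∀ K N → 3 * K + 4 * N * K ≡ K * 1 + (2 * K + 4 * N * K)
  ring₄ = solve-∀
  ring₅ : ∀ K N → 4 * K + 4 * N * K ≡ K * 1 + (3 * K + 4 * N * K)
  ring₅ = solve-∀
  ring₆ : ∀ K N → 6 * K + 4 * N * K ≡ K * 2 + (4 * K + 4 * N * K)
  ring₆ = solve-∀
  ring₇ : ∀ K N → 8 * K + 4 * N * K ≡ K * 2 + (6 * K + 4 * N * K)
  ring₇ = solve-∀
  ring₈ : ∀ K N → 9 * K + 4 * N * K ≡ K * 1 + (8 * K + 4 * N * K)
  ring₈ = solve-∀
  ring₉ : ∀ K N → 10 * K + 4 * N * K ≡ K * 1 + (9 * K + 4 * N * K)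
  ring₉ = solve-∀
  total : ∀ K N → K * 1 + (K * 1 + (K * (4 * N) + (K * 1 + (K * 1 + (K * 2 + (K * 2 + (K * 1 + (K * 1 + (K * (4 * N) + 0)))))))))
                  ≡ K * (2 + 2 * suc N * 4)
  total = solve-∀

blockLabels : ℕ → ℕ → ℕ → List ℕ
blockLabels K N g = copyLabels (Block.weights K N g (K ∸ suc g))

blockLabels-↭ : ∀ K N g → blockLabels K N g ↭ concatMap (λ cl → piece K cl g) (classes K N)
blockLabels-↭ K N g = begin
  copyLabels weights                                  ≡⟨ cong (λ L → ab weights ∷ a'b' weights ∷ L) (concatMap-toℕ (2 * suc N) (Path.labels ∘ pathAt)) ⟩
  ab weights ∷ a'b' weights ∷ concat (applyUpTo (Path.labels ∘ pathAt) (2 * suc N))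
    ≡⟨ cong (λ ps → ab weights ∷ a'b' weights ∷ concat ps) (applyUpTo-2*suc (Path.labels ∘ pathAt) N) ⟩
  ab weights ∷ a'b' weights ∷ Path.labels (pathAt 0) ++ Path.labels (pathAt 1) ++ concat (applyUpTo (Path.labels ∘ restPath low high N) (2 * N))
    ↭⟨ ++⁺ˡ (ab weights ∷ a'b' weights ∷ Path.labels (pathAt 0) ++ Path.labels (pathAt 1)) (restPath-labels-↭ low high N) ⟩
  ab weights ∷ a'b' weights ∷ Path.labels (pathAt 0) ++ Path.labels (pathAt 1) ++ upFrom low (4 * N) ++ downTo high (4 * N)
    ↭⟨ solve 12 (λ ab a'b' ay₀ b'y₀ bz₀ a'z₀ ay₁ b'y₁ bz₁ a'z₁ U D →
                  ab ∙ a'b' ∙ (ay₀ ∙ b'y₀ ∙ bz₀ ∙ a'z₀) ∙ (ay₁ ∙ b'y₁ ∙ bz₁ ∙ a'z₁) ∙ (U ∙ D)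
                ⊜ ab ∙ a'b' ∙ U ∙ ay₀ ∙ a'z₀ ∙ (b'y₁ ∙ a'z₁) ∙ (ay₁ ∙ bz₁) ∙ bz₀ ∙ b'y₀ ∙ D ∙ id)
               ↭-refl [ ab weights ] [ a'b' weights ] [ ay₀ ] [ b'y₀ ] [ bz₀ ] [ a'z₀ ] [ ay₁ ] [ b'y₁ ] [ bz₁ ] [ a'z₁ ] (upFrom low (4 * N)) (downTo high (4 * N)) ⟩
  concatMap (λ cl → piece K cl g) (classes K N) ∎
  where
  open PermutationReasoning
  open Block K N g (K ∸ suc g)
  open Path (pathAt 0) using () renaming (ay to ay₀; b'y to b'y₀; bz to bz₀; a'z to a'z₀)
  open Path (pathAt 1) using () renaming (ay to ay₁; b'y to b'y₁; bz to bz₁; a'z to a'z₁)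

layout-↭ : ∀ K N → concat (applyUpTo (blockLabels K N) K) ↭ applyUpTo suc (K * (2 + 2 * suc N * 4))
layout-↭ K N = begin
  concat (applyUpTo (blockLabels K N) K)                                      ↭⟨ concat-applyUpTo-↭ K (blockLabels-↭ K N) ⟩
  concat (applyUpTo (λ g → concatMap (λ cl → piece K cl g) (classes K N)) K) ↭⟨ distribute K (classes K N) ⟩
  concatMap (λ cl → concat (applyUpTo (piece K cl) K)) (classes K N)          ↭⟨ concatMap-↭ (concat-piece K) (classes K N) ⟩
  concatMap (λ cl → upFrom (offset cl + 1) (K * width cl)) (classes K N)     ≡⟨ tiling-upFrom (classes-tiling K N) ⟩
  upFrom 1 (K * (2 + 2 * suc N * 4))                                          ≡⟨ applyUpTo-suc _ ⟨
  applyUpTo suc (K * (2 + 2 * suc N * 4))                                     ∎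
  where open PermutationReasoning

module _ (K′ N : ℕ) where

  private
    K : ℕ
    K = suc K′
    m : ℕ
    m = 2 * suc N

  componentWeights : ∀ o k → H₂Weights k m
  componentWeights o k ℓ = Block.weights K N (o + toℕ ℓ) (K ∸ suc (o + toℕ ℓ))

  flatten-componentWeights : ∀ o k → flatten (componentWeights o k) ≡ concat (applyUpTo (blockLabels K N ∘ (o +_)) k)
  flatten-componentWeights o k = concatMap-toℕ k (blockLabels K N ∘ (o +_))

  module Component (o k₀ : ℕ) (bound : o + (suc (suc k₀)) ≤ K) where

    W : H₂Weights (suc (suc k₀)) m
    W = componentWeights o (suc (suc k₀))

    g : Fin (suc (suc k₀)) → ℕ
    g ℓ = o + toℕ ℓ

    K≡ : ∀ ℓ → K ≡ suc (g ℓ + (K ∸ suc (g ℓ)))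
    K≡ ℓ = sym (m+[n∸m]≡n (≤-trans (+-monoʳ-< o (toℕ<n ℓ)) bound))

  kindValue : VB m → ℕ
  kindValue va = α K N
  kindValue va' = α K N
  kindValue vb = γ K N + γ K N
  kindValue (vy _) = κ K N
  kindValue (vz _) = κ K N

  component-value : ∀ o k₀ → o + (suc (suc k₀)) ≤ K → ∀ u →
    weightAt (_≟V_ (H₂ (suc (suc k₀)) m)) u (weightedH₂ (componentWeights o (suc (suc k₀)))) ≡ kindValue (proj₂ u)
  component-value o k₀ bound (ℓ , va) = trans (weight-a W ℓ) (at-a-block N (g ℓ) _ (K≡ ℓ))
    where open Component o k₀ bound
  component-value o k₀ bound (ℓ , va') = trans (weight-a' W ℓ) (at-a'-block N (g ℓ) _ (K≡ ℓ))
    where open Component o k₀ bound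
  component-value o k₀ bound (ℓ , vy j) = trans (weight-y W ℓ j) (y-block N (g ℓ) _ (K≡ ℓ) j)
    where open Component o k₀ bound
  component-value o k₀ bound (ℓ , vz j) = trans (weight-z W ℓ j) (z-block N (g ℓ) _ (K≡ ℓ) j)
    where open Component o k₀ bound
  component-value o k₀ bound (ℓ , vb) =
    subst (λ ℓ → weightAt (_≟V_ (H₂ (suc (suc k₀)) m)) (ℓ , vb) (weightedH₂ W) ≡ γ K N + γ K N) (next-prev ℓ)
      (trans (weight-b W (prev ℓ)) (cong₂ _+_ (at-b-block N (g (next (prev ℓ))) _ (K≡ _)) (at-b'-block N (g (prev ℓ)) _ (K≡ _))))
    where open Component o k₀ bound

  All-concatMap-allFin : ∀ {A : Set} {P : A → Set} {k} (f : Fin k → List A) → (∀ i → All P (f i)) → All P (concatMap f (allFin k))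
  All-concatMap-allFin f all = All.concat⁺ (All.map⁺ (All.tabulate⁺ all))

  component-proper : ∀ k → All (λ e → kindValue (proj₂ (proj₁ e)) ≢ kindValue (proj₂ (proj₂ e))) (edges (H₂ k m))
  component-proper k = All-concatMap-allFin (blockEdges k m) λ ℓ →
    α≢γ+γ K′ N ∷ α≢γ+γ K′ N ∷ All-concatMap-allFin (pathEdges ℓ) λ j → α≢κ K′ N ∷ γ+γ≢κ ∷ γ+γ≢κ ∷ α≢κ K′ N ∷ []
    where
    γ+γ≢κ : γ K N + γ K N ≢ κ K N
    γ+γ≢κ = κ≢γ+γ K′ N ∘ sym

  kind : ∀ {t} (ks : Vec ℕ t) → V (unionH₂ (suc N) ks) → VB m
  kind (k ∷ []) (ℓ , v) = v
  kind (k ∷ k′ ∷ ks) (inj₁ (ℓ , v)) = v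
  kind (k ∷ k′ ∷ ks) (inj₂ u) = kind (k′ ∷ ks) u

  unionLabels : ∀ {t} → ℕ → Vec ℕ t → List ℕ
  unionLabels o [] = []
  unionLabels o (k ∷ []) = flatten (componentWeights o k)
  unionLabels o (k ∷ k′ ∷ ks) = flatten (componentWeights o k) ++ unionLabels (o + k) (k′ ∷ ks)

  unionLabels≡ : ∀ {t} o (ks : Vec ℕ t) → unionLabels o ks ≡ concat (applyUpTo (blockLabels K N ∘ (o +_)) (Vec.sum ks))
  unionLabels≡ o [] = refl
  unionLabels≡ o (k ∷ []) = trans (flatten-componentWeights o k) (cong (concat ∘ applyUpTo (blockLabels K N ∘ (o +_))) (sym (+-identityʳ k)))
  unionLabels≡ o (k ∷ k′ ∷ ks) = begin
    flatten (componentWeights o k) ++ unionLabels (o + k) (k′ ∷ ks)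
      ≡⟨ cong₂ _++_ (flatten-componentWeights o k) (unionLabels≡ (o + k) (k′ ∷ ks)) ⟩
    concat (applyUpTo f k) ++ concat (applyUpTo (blockLabels K N ∘ (o + k +_)) (Vec.sum (k′ ∷ ks)))
      ≡⟨ cong (λ bs → concat (applyUpTo f k) ++ concat bs) (applyUpTo-cong (λ i → cong (blockLabels K N) (+-assoc o k i)) (Vec.sum (k′ ∷ ks))) ⟩
    concat (applyUpTo f k) ++ concat (applyUpTo (f ∘ (k +_)) (Vec.sum (k′ ∷ ks)))
      ≡⟨ concat-++ (applyUpTo f k) _ ⟩
    concat (applyUpTo f k ++ applyUpTo (f ∘ (k +_)) (Vec.sum (k′ ∷ ks)))
      ≡⟨ cong concat (applyUpTo-+ f k _) ⟨
    concat (applyUpTo f (k + Vec.sum (k′ ∷ ks)))                       ∎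
    where
    open ≡-Reasoning
    f : ℕ → List ℕ
    f = blockLabels K N ∘ (o +_)

  length-flatten : ∀ {k} (W : H₂Weights k m) → length (flatten W) ≡ q (H₂ k m)
  length-flatten {k} W = trans (length-concatMap-allFin k (copyLabels ∘ W) λ ℓ → length-copyLabels {k} (W ℓ)) (sym (q-H₂ {k} {m}))

  q-unionH₂ : ∀ {t} (ks : Vec ℕ t) → q (unionH₂ (suc N) ks) ≡ Vec.sum ks * (2 + m * 4)
  q-unionH₂ [] = refl
  q-unionH₂ (k ∷ []) = trans (q-H₂ {k} {m}) (cong (_* (2 + m * 4)) (sym (+-identityʳ k)))
  q-unionH₂ (k ∷ k′ ∷ ks) =
    trans (q-⊕ (H₂ k m) (unionH₂ (suc N) (k′ ∷ ks))) (trans (cong₂ _+_ (q-H₂ {k} {m}) (q-unionH₂ (k′ ∷ ks))) (sym (*-distribʳ-+ (2 + m * 4) k _)))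

  component-at : ∀ o k₀ → o + (suc (suc k₀)) ≤ K → ∀ u →
    weightAt (_≟V_ (H₂ (suc (suc k₀)) m)) u (zip (edges (H₂ (suc (suc k₀)) m)) (flatten (componentWeights o (suc (suc k₀))))) ≡ kindValue (proj₂ u)
  component-at o k₀ bound u = trans (cong (weightAt _ u) (zip-H₂ (componentWeights o (suc (suc k₀))))) (component-value o k₀ bound u)

  union-value : ∀ {t} o (ks : Vec ℕ t) → (∀ i → 2 ≤ Vec.lookup ks i) → o + Vec.sum ks ≤ K → ∀ u →
    weightAt (_≟V_ (unionH₂ (suc N) ks)) u (zip (edges (unionH₂ (suc N) ks)) (unionLabels o ks)) ≡ kindValue (kind ks u)
  union-value o (0 ∷ ks) 2≤ bound u with () ← 2≤ fzero
  union-value o (1 ∷ ks) 2≤ bound u with s≤s () ← 2≤ fzero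
  union-value o (suc (suc k₀) ∷ []) 2≤ bound u = component-at o k₀ (subst (λ x → o + x ≤ K) (+-identityʳ _) bound) u
  union-value o (suc (suc k₀) ∷ k′ ∷ ks) 2≤ bound (inj₁ u) =
    trans (weightAt-⊕ˡ (H₂ (suc (suc k₀)) m) _ _ _ (length-flatten (componentWeights o (suc (suc k₀)))) u)
          (component-at o k₀ (≤-trans (+-monoʳ-≤ o (m≤m+n (suc (suc k₀)) _)) bound) u)
  union-value o (suc (suc k₀) ∷ k′ ∷ ks) 2≤ bound (inj₂ u) =
    trans (weightAt-⊕ʳ (H₂ (suc (suc k₀)) m) _ _ _ (length-flatten (componentWeights o (suc (suc k₀)))) u)
          (union-value (o + (suc (suc k₀))) (k′ ∷ ks) (2≤ ∘ fsuc) (subst (_≤ K) (sym (+-assoc o (suc (suc k₀)) _)) bound) u)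

  union-proper : ∀ {t} (ks : Vec ℕ t) →
    All (λ e → kindValue (kind ks (proj₁ e)) ≢ kindValue (kind ks (proj₂ e))) (edges (unionH₂ (suc N) ks))
  union-proper [] = []
  union-proper (k ∷ []) = component-proper k
  union-proper (k ∷ k′ ∷ ks) = All.++⁺ (All.map⁺ (component-proper k)) (All.map⁺ (union-proper (k′ ∷ ks)))

  kindValue-cases : ∀ v → kindValue v ≡ κ K N ⊎ kindValue v ≡ α K N ⊎ kindValue v ≡ γ K N + γ K N
  kindValue-cases va = inj₂ (inj₁ refl)
  kindValue-cases va' = inj₂ (inj₁ refl)
  kindValue-cases vb = inj₂ (inj₂ refl)
  kindValue-cases (vy _) = inj₁ refl
  kindValue-cases (vz _) = inj₁ refl

  vertex-of-kind : ∀ {t} (ks : Vec ℕ (suc t)) → 2 ≤ Vec.lookup ks fzero → ∀ v → ∃ λ u → kind ks u ≡ v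
  vertex-of-kind (suc k ∷ []) _ v = (fzero , v) , refl
  vertex-of-kind (suc k ∷ k′ ∷ ks) _ v = inj₁ (fzero , v) , refl

  unionLabels-↭ : ∀ {t} (ks : Vec ℕ t) → Vec.sum ks ≡ K → unionLabels 0 ks ↭ applyUpTo suc (q (unionH₂ (suc N) ks))
  unionLabels-↭ ks sum≡K = begin
    unionLabels 0 ks                                  ≡⟨ unionLabels≡ 0 ks ⟩
    concat (applyUpTo (blockLabels K N) (Vec.sum ks)) ≡⟨ cong (concat ∘ applyUpTo (blockLabels K N)) sum≡K ⟩
    concat (applyUpTo (blockLabels K N) K)            ↭⟨ layout-↭ K N ⟩
    applyUpTo suc (K * (2 + 2 * suc N * 4))           ≡⟨ cong (λ x → applyUpTo suc (x * (2 + 2 * suc N * 4))) sum≡K ⟨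
    applyUpTo suc (Vec.sum ks * (2 + 2 * suc N * 4))  ≡⟨ cong (applyUpTo suc) (q-unionH₂ ks) ⟨
    applyUpTo suc (q (unionH₂ (suc N) ks))            ∎
    where open PermutationReasoning

  antimagic-labeling-with-three-values : ∀ {t} (ks : Vec ℕ (suc t)) → Vec.sum ks ≡ K → (∀ i → 2 ≤ Vec.lookup ks i) →
    ∃ λ (π : Labeling (unionH₂ (suc N) ks)) → LocalAntimagic (unionH₂ (suc N) ks) π × HasNValues (vsum (unionH₂ (suc N) ks) π) 3
  antimagic-labeling-with-three-values ks sum≡K 2≤ = π , antimagic , three-values (vsum G π) (κ K N) (α K N) (γ K N + γ K N)
      (α≢κ K′ N ∘ sym) (κ≢γ+γ K′ N) (α≢γ+γ K′ N)
      (λ u → subst (λ x → x ≡ κ K N ⊎ x ≡ α K N ⊎ x ≡ γ K N + γ K N) (sym (vsum≡kindValue u)) (kindValue-cases (kind ks u)))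
      (attains (vy fzero)) (attains va) (attains vb)
    where
    G : Graph
    G = unionH₂ (suc N) ks

    π : Labeling G
    π = proj₁ (labeling-from-↭ G (unionLabels 0 ks) (unionLabels-↭ ks sum≡K))

    vsum≡kindValue : ∀ u → vsum G π u ≡ kindValue (kind ks u)
    vsum≡kindValue u = begin
      vsum G π u                                                ≡⟨ vsum≡weightAt G π u ⟩
      weightAt (_≟V_ G) u (zip (edges G) (edgeLabels G π))          ≡⟨ cong (weightAt (_≟V_ G) u ∘ zip (edges G)) (proj₂ (labeling-from-↭ G (unionLabels 0 ks) (unionLabels-↭ ks sum≡K))) ⟩
      weightAt (_≟V_ G) u (zip (edges G) (unionLabels 0 ks))    ≡⟨ union-value 0 ks 2≤ (≤-reflexive sum≡K) u ⟩
      kindValue (kind ks u)                                     ∎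
      where open ≡-Reasoning

    antimagic : LocalAntimagic G π
    antimagic e eq = All-lookup (union-proper ks) (∈-lookup e)
      (trans (sym (vsum≡kindValue (proj₁ (ends G e)))) (trans eq (vsum≡kindValue (proj₂ (ends G e)))))

    attains : ∀ v → ∃ λ u → vsum G π u ≡ kindValue v
    attains v = proj₁ u , trans (vsum≡kindValue (proj₁ u)) (cong kindValue (proj₂ u))
      where
      u : ∃ λ u → kind ks u ≡ v
      u = vertex-of-kind ks (2≤ fzero) v

corollary2p15 : (n t : ℕ) (ks : Vec ℕ t) → 1 ≤ n → 2 ≤ t →
    (∀ (i : Fin t) → 2 ≤ lookup ks i) → χla≡ (unionH₂ n ks) 3
corollary2p15 zero _ _ () _ _
corollary2p15 (suc N) 1 (_ ∷ []) _ (s≤s ()) _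
corollary2p15 (suc N) _ (0 ∷ _ ∷ _) _ _ 2≤ with () ← 2≤ fzero
corollary2p15 (suc N) _ (1 ∷ _ ∷ _) _ _ 2≤ with s≤s () ← 2≤ fzero
corollary2p15 (suc N) _ (suc (suc k₀) ∷ k₂ ∷ ks) _ _ 2≤ =
  antimagic-labeling-with-three-values (suc (k₀ + Vec.sum (k₂ ∷ ks))) N (suc (suc k₀) ∷ k₂ ∷ ks) refl 2≤ ,
  λ π antimagic → χla-H₂⊕-lower k₀ (2 * suc N) fzero _ π antimagic
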